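{- Let $(T,\lambda)$ be an edge-labeled phylogenetic tree on $L$ that is least-resolved w.r.t. $\mathcal{X}=\mathcal{X}_{(T,\lambda)}$, and let $v\in L$. Let $(T',\lambda')$ be the least-resolved phylogenetic tree w.r.t. $\mathcal{X}_{\neg v}$. Then $(T',\lambda')$ is displayed by $(T-v,\lambda_{|L-v})$. Moreover, $(T',\lambda')=(T-v,\lambda_{|L-v})$ if and only if (i) $\mathsf{par}(v)=\rho_T$ and $\deg_T(\rho_T)>2$, or (ii) $\deg_T(\mathsf{par}(v))>3$ and $\lambda(\mathsf{par}(v),u)=0$ for some child $u\neq v$ of $\mathsf{par}(v)$.
   Context: Rooted tree $T$, root $\rho_T$ (an inner vertex); phylogenetic: $\deg(\rho_T)\ge2$, other inner vertices degree $\ge3$ (degree counts all incident edges). $\mathsf{par}(v)$ is the parent of $v$. $\lambda:E\to\{0,1\}$. $\mathcal{X}_{(T,\lambda)}$: $(x,y)$ for distinct leaves with a 1-edge on the path from $\operatorname{lca}(x,y)$ to $y$; explains means equality. Extended contraction $(T_e,\lambda_e)$ of $e=(u,v)$: contract $e$ keeping other labels; if $e$ is outer, the leaf $v$ is lost and a resulting degree-1 root is deleted (its child becoming root), or a resulting non-root degree-2 vertex $u$ (parent $w$, child $w'$) is suppressed into an edge $(w,w')$ labeled $1$ iff $(w,u)$ or $(u,w')$ was. Least-resolved: explains $\mathcal{X}$ and no $(T_e,\lambda_e)$ does; a valid relation has a unique least-resolved tree. $\mathcal{X}_{\neg v}$ is the subrelation of $\mathcal{X}$ induced by $L\setminus\{v\}$.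 $(T-v,\lambda_{|L-v})$ is obtained from $(T,\lambda)$ by deleting the leaf $v$ and its incident edge and keeping all other labels (it need not be phylogenetic). Display: $(T,\lambda)$ displays $(T',\lambda')$ on $L'$ if $T'$ is obtained from the subtree of $T$ spanned by $L'$ via simple edge contractions and an edge of $T'$ is labeled $1$ iff the corresponding path of $T$ contains a 1-edge. -}

module Defs where

open import Data.Nat using (ℕ; suc; _≤_; _<_; _≟_)
open import Data.Bool using (Bool; true; false; if_then_else_; _∨_)
open import Data.List using (List; []; _∷_; _++_; length; map)
open import Data.Bool.ListAction using (any)
open import Data.List.Membership.Propositional using (_∈_; _∉_)
open import Data.List.Relation.Unary.Any using (Any)
open import Data.List.Relation.Unary.Unique.Propositional using (Unique)
open import Data.List.Relation.Binary.Permutation.Homogeneous using (Permutation)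
open import Data.Maybe using (Maybe; just; nothing)
open import Data.Product using (Σ; _×_; _,_; proj₁; proj₂; ∃)
open import Data.Sum using (_⊎_)
open import Data.Empty using (⊥)
open import Data.Unit using (⊤)
open import Relation.Nullary using (¬_; does)
open import Relation.Binary.PropositionalEquality using (_≡_; _≢_)
open import Relation.Binary.Construct.Closure.ReflexiveTransitive using (Star)
open import Function.Bundles using (_⇔_)

-- A tree is a leaf (carrying its name, a natural number) or an inner
-- vertex with a list of children; each child comes with the label
-- λ ∈ {0,1} (false = 0, true = 1) of the edge from this vertex to it.
-- The order of the children is irrelevant (see _≅_ below).

data Tree : Set where
  leaf : ℕ → Tree
  node : List (Bool × Tree) → Tree

Children : Set
Children = List (Bool × Tree)

mutual
  leavesT : Tree → List ℕ
  leavesT (leaf x)  = x ∷ []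
  leavesT (node cs) = leavesL cs

  leavesL : Children → List ℕ
  leavesL []             = []
  leavesL ((b , c) ∷ cs) = leavesT c ++ leavesL cs

mutual
  onesT : Tree → List ℕ
  onesT (leaf x)  = []
  onesT (node cs) = onesL cs

  onesL : Children → List ℕ
  onesL []             = []
  onesL ((b , c) ∷ cs) = (if b then leavesT c else onesT c) ++ onesL cs

-- The relation X_(T,λ): (x , y) with x ≠ y leaves and a 1-edge on the path
-- from lca(x,y) to y.  At a vertex with children cs, either both x and y lie
-- below the same child (recurse), or the vertex is lca(x,y): y lies below a
-- child c (edge label b) and x lies below a different child.
mutual
  XT : Tree → ℕ → ℕ → Set
  XT (leaf _)  x y = ⊥
  XT (node cs) x y =
    XL cs x y ⊎
    Any (λ p → (y ∈ (if proj₁ p then leavesT (proj₂ p) else onesT (proj₂ p)))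
               × (x ∈ leavesT (node cs)) × (x ∉ leavesT (proj₂ p))) cs

  XL : Children → ℕ → ℕ → Set
  XL []             x y = ⊥
  XL ((b , c) ∷ cs) x y = XT c x y ⊎ XL cs x y

-- Phylogenetic: the root is an inner vertex with ≥ 2 children, every
-- other inner vertex has degree ≥ 3 (i.e. ≥ 2 children), leaves distinct.
mutual
  PhyT : Tree → Set
  PhyT (leaf _)  = ⊤
  PhyT (node cs) = (2 ≤ length cs) × PhyL cs

  PhyL : Children → Set
  PhyL []             = ⊤
  PhyL ((b , c) ∷ cs) = PhyT c × PhyL cs

IsInner : Tree → Set
IsInner (leaf _) = ⊥
IsInner (node _) = ⊤

Phylogenetic : Tree → Set
Phylogenetic T = IsInner T × PhyT T × Unique (leavesT T)

data _≅_ : Tree → Tree → Set where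
  leaf≅ : ∀ {x} → leaf x ≅ leaf x
  node≅ : ∀ {cs ds} →
          Permutation (λ p q → (proj₁ p ≡ proj₁ q) × (proj₂ p ≅ proj₂ q)) cs ds →
          node cs ≅ node ds

Explains : (ℕ → Set) → (ℕ → ℕ → Set) → Tree → Set
Explains L X T = (∀ x → L x ⇔ (x ∈ leavesT T)) × (∀ x y → X x y ⇔ XT T x y)

-- suppression of a non-root vertex of degree 2 hanging below an edge labeled b:
-- the edges (w,u),(u,w') become one edge (w,w') labeled λ(w,u) ∨ λ(u,w')
fixChild : Bool → Tree → Bool × Tree
fixChild b (node ((b' , c) ∷ [])) = (b ∨ b' , c)
fixChild b t                      = (b , t)

-- deletion of a degree-1 root (its child becomes the root)
fixRoot : Tree → Tree
fixRoot (node ((b , c) ∷ [])) = c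
fixRoot t                     = t

-- contraction of a single edge, before the fix-up of the topmost vertex
data ContrStep : Tree → Tree → Set where
  inner : ∀ pre b ds post →
          ContrStep (node (pre ++ (b , node ds) ∷ post)) (node (pre ++ ds ++ post))
  outer : ∀ pre b x post →
          ContrStep (node (pre ++ (b , leaf x) ∷ post)) (node (pre ++ post))
  deep  : ∀ pre b {c c'} post → ContrStep c c' →
          ContrStep (node (pre ++ (b , c) ∷ post)) (node (pre ++ fixChild b c' ∷ post))

ExtContr : Tree → Tree → Set
ExtContr T Te = Σ Tree (λ T₁ → ContrStep T T₁ × (Te ≡ fixRoot T₁))

LeastResolved : (ℕ → Set) → (ℕ → ℕ → Set) → Tree → Set
LeastResolved L X T = Explains L X T × (∀ Te → ExtContr T Te → ¬ Explains L X Te)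

mutual
  deleteT : ℕ → Tree → Tree
  deleteT v (leaf x)  = leaf x
  deleteT v (node cs) = node (deleteL v cs)

  deleteL : ℕ → Children → Children
  deleteL v []                  = []
  deleteL v ((b , leaf x) ∷ cs) = if does (x ≟ v) then deleteL v cs else (b , leaf x) ∷ deleteL v cs
  deleteL v ((b , node ds) ∷ cs) = (b , node (deleteL v ds)) ∷ deleteL v cs

-- Subtree spanned by L': keep leaves in L', remove vertices without
-- remaining leaves, suppress degree-2 vertices (the new edge is labeled 1
-- iff the replaced path contains a 1-edge), and start at lca(L').

member : ℕ → List ℕ → Bool
member x L = any (λ y → does (x ≟ y)) L

mutual
  restrictT : List ℕ → Tree → Maybe Tree
  restrictT L (leaf x)  = if member x L then just (leaf x) else nothing
  restrictT L (node cs) with restrictL L cs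
  ... | []       = nothing
  ... | (d ∷ ds) = just (node (d ∷ ds))

  restrictL : List ℕ → Children → Children
  restrictL L [] = []
  restrictL L ((b , c) ∷ cs) with restrictT L c
  ... | nothing = restrictL L cs
  ... | just c' = (b , c') ∷ restrictL L cs

mutual
  suppT : Tree → Tree
  suppT (leaf x)  = leaf x
  suppT (node cs) = node (suppL cs)

  suppL : Children → Children
  suppL []             = []
  suppL ((b , c) ∷ cs) = fixChild b (suppT c) ∷ suppL cs

span : List ℕ → Tree → Maybe Tree
span L T with restrictT L T
... | nothing = nothing
... | just S  = just (fixRoot (suppT S))

-- simple contraction of an inner edge (u,x) in the display sense: every
-- edge (x,c) becomes an edge (u,c) whose corresponding path u-x-c of T
-- contains a 1-edge iff λ(u,x) = 1 or λ(x,c) = 1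
orLabel : Bool → Bool × Tree → Bool × Tree
orLabel b (b' , c) = (b ∨ b' , c)

data DContr : Tree → Tree → Set where
  here : ∀ pre b ds post →
         DContr (node (pre ++ (b , node ds) ∷ post)) (node (pre ++ map (orLabel b) ds ++ post))
  deep : ∀ pre b {c c'} post → DContr c c' →
         DContr (node (pre ++ (b , c) ∷ post)) (node (pre ++ (b , c') ∷ post))

Displays : Tree → Tree → Set
Displays T T' = Σ Tree (λ S → (span (leavesT T') T ≡ just S) ×
                 Σ Tree (λ T₀ → Star DContr S T₀ × (T₀ ≅ T')))

-- Vertex T r cs : T has a vertex with child list cs; r = true iff it is the root
data Vertex : Tree → Bool → Children → Set where
  root  : ∀ {cs} → Vertex (node cs) true cs
  below : ∀ {cs p r ds} → p ∈ cs → Vertex (proj₂ p) r ds → Vertex (node cs) false ds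

-- degree of a vertex with child list cs (the parent edge counts if non-root)
deg : Bool → Children → ℕ
deg true  cs = length cs
deg false cs = suc (length cs)

HasLeafChild : ℕ → Children → Set
HasLeafChild v cs = Any (λ p → proj₂ p ≡ leaf v) cs

CondI : Tree → ℕ → Set
CondI T v = Σ Children (λ cs → Vertex T true cs × HasLeafChild v cs × (2 < deg true cs))

CondII : Tree → ℕ → Set
CondII T v = Σ Bool (λ r → Σ Children (λ cs → Vertex T r cs × HasLeafChild v cs ×
               (3 < deg r cs) × Any (λ p → (proj₁ p ≡ false) × (proj₂ p ≢ leaf v)) cs))

module Submission where

-- Call a tree *reduced* if every inner edge is a 1-edge into a vertex with a
-- *zero leaf* (a leaf reached from it along 0-edges only).  Two facts drive
-- the proof.  (A) A least-resolved phylogenetic tree is reduced: an edge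
-- violating the condition can be contracted without changing X.  (B) Reduced
-- phylogenetic trees on the same leaves explaining the same relation are
-- isomorphic: leaves x, y lie below a common child of the root iff x = y or
-- some X-target (a zero leaf of that child) is X-related from neither.
-- The relation of T - v is X restricted to L - v.  Display: suppressing the
-- degree-2 vertices of T - v and contracting the inner edges whose lower end
-- lost its zero leaves gives a reduced phylogenetic tree explaining X_{¬v},
-- which is T' by (B).  Equivalence: T - v is phylogenetic and reduced exactly
-- under (i) or (ii), and these properties are invariant under ≅.

open import Defs
open import Data.Nat using (ℕ; suc; _≤_; _<_; _≟_; _≡ᵇ_; s≤s; z≤n; _+_)
open import Data.Nat.Properties
  using (≤-trans; ≤-pred; ≤-reflexive; <⇒≤; m≤m+n; m≤n+m; m≤n⇒m≤1+n; +-monoˡ-≤; module ≤-Reasoning)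
open import Data.Bool using (Bool; true; false; if_then_else_; _∨_)
open import Data.Bool.Properties using (∨-zeroʳ)
open import Data.List using (List; []; _∷_; _++_; length; map; [_])
open import Data.List.Properties using (++-assoc; ++-identityʳ; length-++; length-map)
open import Data.List.Membership.Propositional using (_∈_; _∉_; find; lose)
open import Data.List.Membership.Propositional.Properties
  using (∈-++⁺ˡ; ∈-++⁺ʳ; ∈-++⁻; ∈-∃++)
open import Data.List.Membership.DecPropositional _≟_ using (_∈?_)
open import Data.List.Relation.Unary.Any using (Any; here; there)
open import Data.List.Relation.Unary.Any.Properties using (¬Any[])
open import Data.List.Relation.Unary.All using (All; []; _∷_; lookup; tabulate)
open import Data.List.Relation.Unary.AllPairs using ([]; _∷_)
open import Data.List.Relation.Unary.Unique.Propositional using (Unique)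
import Data.List.Relation.Unary.Unique.Propositional.Properties as Unique
open import Data.List.Relation.Binary.Pointwise as Pointwise using (Pointwise; []; _∷_)
open import Data.List.Relation.Binary.Permutation.Homogeneous using (Permutation)
open import Data.Maybe using (just)
open import Data.Product using (Σ; _×_; _,_; proj₁; proj₂; map₁)
open import Data.Sum using (_⊎_; inj₁; inj₂)
open import Data.Empty using (⊥-elim)
open import Data.Unit using (⊤; tt)
open import Relation.Nullary using (¬_; does; proof; yes; no)
open import Relation.Nullary.Decidable using (dec-true)
open import Relation.Nullary.Reflects using (ofʸ; ofⁿ)
open import Relation.Binary.PropositionalEquality
  using (_≡_; _≢_; refl; sym; trans; cong; cong₂; subst; subst₂; module ≡-Reasoning)
open import Relation.Binary.Construct.Closure.ReflexiveTransitive using (Star; ε; _◅_; _◅◅_)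
open import Function.Bundles using (_⇔_; mk⇔; Equivalence)

_⊆_ : List ℕ → List ℕ → Set
xs ⊆ ys = ∀ {x} → x ∈ xs → x ∈ ys

_≈ₗ_ : List ℕ → List ℕ → Set
xs ≈ₗ ys = (xs ⊆ ys) × (ys ⊆ xs)

≈ₗ-reflexive : ∀ {xs ys} → xs ≡ ys → xs ≈ₗ ys
≈ₗ-reflexive refl = (λ i → i) , (λ i → i)

≈ₗ-refl : ∀ {xs} → xs ≈ₗ xs
≈ₗ-refl = ≈ₗ-reflexive refl

≈ₗ-trans : ∀ {xs ys zs} → xs ≈ₗ ys → ys ≈ₗ zs → xs ≈ₗ zs
≈ₗ-trans (f , g) (f' , g') = (λ i → f' (f i)) , (λ i → g (g' i))

Unique-++⁻ : ∀ {xs ys : List ℕ} → Unique (xs ++ ys) →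
             Unique xs × Unique ys × (∀ {x} → x ∈ xs → x ∉ ys)
Unique-++⁻ {[]} u = [] , u , λ ()
Unique-++⁻ {x ∷ xs} {ys} (x∉ ∷ u) with Unique-++⁻ {xs} {ys} u
... | uxs , uys , disj =
  tabulate (λ i → lookup x∉ (∈-++⁺ˡ i)) ∷ uxs , uys ,
  λ { (here refl) j → lookup x∉ (∈-++⁺ʳ xs j) refl ; (there i) j → disj i j }

Unique-++⁺ : ∀ {xs ys : List ℕ} → Unique xs → Unique ys →
             (∀ {x} → x ∈ xs → x ∉ ys) → Unique (xs ++ ys)
Unique-++⁺ uxs uys disj = Unique.++⁺ uxs uys (λ { (i , j) → disj i j })

∈-insert⁻ : ∀ {A : Set} (pre : List A) {ds post x} →
            x ∈ pre ++ ds ++ post → (x ∈ pre ++ post) ⊎ (x ∈ ds)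
∈-insert⁻ [] {ds} i with ∈-++⁻ ds i
... | inj₁ j = inj₂ j
... | inj₂ j = inj₁ j
∈-insert⁻ (a ∷ pre) (here e) = inj₁ (here e)
∈-insert⁻ (a ∷ pre) (there i) with ∈-insert⁻ pre i
... | inj₁ j = inj₁ (there j)
... | inj₂ j = inj₂ j

∈-insert⁺ : ∀ {A : Set} (pre : List A) {ds post x} → x ∈ pre ++ post → x ∈ pre ++ ds ++ post
∈-insert⁺ [] {ds} i = ∈-++⁺ʳ ds i
∈-insert⁺ (a ∷ pre) (here e) = here e
∈-insert⁺ (a ∷ pre) (there i) = there (∈-insert⁺ pre i)

∈-inserted : ∀ {A : Set} (pre : List A) {ds post x} → x ∈ ds → x ∈ pre ++ ds ++ post
∈-inserted pre i = ∈-++⁺ʳ pre (∈-++⁺ˡ i)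

∈-splice⁻ : ∀ {A : Set} (pre : List A) {q post x} → x ∈ pre ++ q ∷ post → (x ∈ pre ++ post) ⊎ (x ≡ q)
∈-splice⁻ pre {q} i with ∈-insert⁻ pre {[ q ]} i
... | inj₁ j = inj₁ j
... | inj₂ (here e) = inj₂ e

∈-spliced : ∀ {A : Set} (pre : List A) {q post} → q ∈ pre ++ q ∷ post
∈-spliced pre = ∈-++⁺ʳ pre (here refl)

-- A child  p = (λ(e), c)  of a vertex: its leaves, and its *one-leaves*, the
-- leaves y of c with a 1-edge on the path from the vertex to y.  The
-- one-leaves are exactly the possible targets of X-pairs with lca at the vertex.
leavesC : Bool × Tree → List ℕ
leavesC p = leavesT (proj₂ p)

onesC : Bool × Tree → List ℕ
onesC p = if proj₁ p then leavesT (proj₂ p) else onesT (proj₂ p)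

leavesL-++ : ∀ xs ys → leavesL (xs ++ ys) ≡ leavesL xs ++ leavesL ys
leavesL-++ [] ys = refl
leavesL-++ ((b , c) ∷ xs) ys =
  trans (cong (leavesT c ++_) (leavesL-++ xs ys)) (sym (++-assoc (leavesT c) (leavesL xs) (leavesL ys)))

leavesL⁺ : ∀ cs {p} → p ∈ cs → leavesC p ⊆ leavesL cs
leavesL⁺ ((b , c) ∷ cs) (here refl) i = ∈-++⁺ˡ i
leavesL⁺ ((b , c) ∷ cs) (there j) i = ∈-++⁺ʳ (leavesT c) (leavesL⁺ cs j i)

leavesL⁻ : ∀ cs {x} → x ∈ leavesL cs → Σ (Bool × Tree) (λ p → p ∈ cs × x ∈ leavesC p)
leavesL⁻ ((b , c) ∷ cs) i with ∈-++⁻ (leavesT c) i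
... | inj₁ j = (b , c) , here refl , j
... | inj₂ j with leavesL⁻ cs j
... | p , k , l = p , there k , l

onesL⁺ : ∀ cs {p} → p ∈ cs → onesC p ⊆ onesL cs
onesL⁺ ((b , c) ∷ cs) (here refl) i = ∈-++⁺ˡ i
onesL⁺ ((b , c) ∷ cs) (there k) i = ∈-++⁺ʳ (onesC (b , c)) (onesL⁺ cs k i)

onesL⁻ : ∀ cs {y} → y ∈ onesL cs → Σ (Bool × Tree) (λ p → p ∈ cs × y ∈ onesC p)
onesL⁻ ((b , c) ∷ cs) i with ∈-++⁻ (onesC (b , c)) i
... | inj₁ j = (b , c) , here refl , j
... | inj₂ j with onesL⁻ cs j
... | p , k , l = p , there k , l

mutual
  ones⊆leaves : ∀ t → onesT t ⊆ leavesT t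
  ones⊆leaves (leaf x) ()
  ones⊆leaves (node cs) i = onesL⊆leavesL cs i

  onesL⊆leavesL : ∀ cs → onesL cs ⊆ leavesL cs
  onesL⊆leavesL ((b , c) ∷ cs) i with ∈-++⁻ (onesC (b , c)) i
  ... | inj₂ j = ∈-++⁺ʳ (leavesT c) (onesL⊆leavesL cs j)
  onesL⊆leavesL ((true , c) ∷ cs) i | inj₁ j = ∈-++⁺ˡ j
  onesL⊆leavesL ((false , c) ∷ cs) i | inj₁ j = ∈-++⁺ˡ (ones⊆leaves c j)

onesC⊆leavesC : ∀ p → onesC p ⊆ leavesC p
onesC⊆leavesC (true , c) i = i
onesC⊆leavesC (false , c) i = ones⊆leaves c i

sharedLeaf : ∀ cs → Unique (leavesL cs) → ∀ {p q} → p ∈ cs → q ∈ cs →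
             ∀ {x} → x ∈ leavesC p → x ∈ leavesC q → p ≡ q
sharedLeaf ((b , c) ∷ cs) u (here refl) (here refl) i j = refl
sharedLeaf ((b , c) ∷ cs) u (here refl) (there k) i j =
  ⊥-elim (proj₂ (proj₂ (Unique-++⁻ {leavesT c} u)) i (leavesL⁺ cs k j))
sharedLeaf ((b , c) ∷ cs) u (there k) (here refl) i j =
  ⊥-elim (proj₂ (proj₂ (Unique-++⁻ {leavesT c} u)) j (leavesL⁺ cs k i))
sharedLeaf ((b , c) ∷ cs) u (there k) (there l) i j =
  sharedLeaf cs (proj₁ (proj₂ (Unique-++⁻ {leavesT c} u))) k l i j

uniqueChild : ∀ cs → Unique (leavesL cs) → ∀ {p} → p ∈ cs → Unique (leavesC p)
uniqueChild ((b , c) ∷ cs) u (here refl) = proj₁ (Unique-++⁻ {leavesT c} u)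
uniqueChild ((b , c) ∷ cs) u (there k) = uniqueChild cs (proj₁ (proj₂ (Unique-++⁻ {leavesT c} u))) k

XAt : Children → ℕ → ℕ → Set
XAt cs x y = Σ (Bool × Tree) (λ p → p ∈ cs × XT (proj₂ p) x y)
           ⊎ (x ∈ leavesL cs) × Σ (Bool × Tree) (λ p → p ∈ cs × y ∈ onesC p × x ∉ leavesC p)

XL⇒child : ∀ cs {x y} → XL cs x y → Σ (Bool × Tree) (λ p → p ∈ cs × XT (proj₂ p) x y)
XL⇒child ((b , c) ∷ cs) (inj₁ h) = (b , c) , here refl , h
XL⇒child ((b , c) ∷ cs) (inj₂ h) with XL⇒child cs h
... | p , i , h' = p , there i , h'

child⇒XL : ∀ cs {p} → p ∈ cs → ∀ {x y} → XT (proj₂ p) x y → XL cs x y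
child⇒XL ((b , c) ∷ cs) (here refl) h = inj₁ h
child⇒XL ((b , c) ∷ cs) (there i) h = inj₂ (child⇒XL cs i h)

XT⇒XAt : ∀ cs {x y} → XT (node cs) x y → XAt cs x y
XT⇒XAt cs (inj₁ h) = inj₁ (XL⇒child cs h)
XT⇒XAt cs (inj₂ h) with find h
... | p , i , (y∈ , x∈ , x∉) = inj₂ (x∈ , p , i , y∈ , x∉)

XT-below : ∀ cs {p} → p ∈ cs → ∀ {x y} → XT (proj₂ p) x y → XT (node cs) x y
XT-below cs i h = inj₁ (child⇒XL cs i h)

XT-at : ∀ cs {p} → p ∈ cs → ∀ {x y} → x ∈ leavesL cs → x ∉ leavesC p → y ∈ onesC p → XT (node cs) x y
XT-at cs i x∈ x∉ y∈ = inj₂ (lose i (y∈ , x∈ , x∉))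

mutual
  source∈leaves : ∀ t {x y} → XT t x y → x ∈ leavesT t
  source∈leaves (leaf _) ()
  source∈leaves (node cs) (inj₁ h) = sourceL cs h
  source∈leaves (node cs) (inj₂ h) with find h
  ... | p , i , (_ , x∈ , _) = x∈

  sourceL : ∀ cs {x y} → XL cs x y → x ∈ leavesL cs
  sourceL ((b , c) ∷ cs) (inj₁ h) = ∈-++⁺ˡ (source∈leaves c h)
  sourceL ((b , c) ∷ cs) (inj₂ h) = ∈-++⁺ʳ (leavesT c) (sourceL cs h)

ones⊆onesC : ∀ b c → onesT c ⊆ onesC (b , c)
ones⊆onesC true c i = ones⊆leaves c i
ones⊆onesC false c i = i

mutual
  target∈ones : ∀ t {x y} → XT t x y → y ∈ onesT t
  target∈ones (leaf _) ()
  target∈ones (node cs) (inj₁ h) = targetL cs h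
  target∈ones (node cs) (inj₂ h) with find h
  ... | p , i , (y∈ , _ , _) = onesL⁺ cs i y∈

  targetL : ∀ cs {x y} → XL cs x y → y ∈ onesL cs
  targetL ((b , c) ∷ cs) (inj₁ h) = ∈-++⁺ˡ (ones⊆onesC b c (target∈ones c h))
  targetL ((b , c) ∷ cs) (inj₂ h) = ∈-++⁺ʳ (onesC (b , c)) (targetL cs h)

target∈leaves : ∀ t {x y} → XT t x y → y ∈ leavesT t
target∈leaves t h = ones⊆leaves t (target∈ones t h)

onesL-child : ∀ cs → Unique (leavesL cs) → ∀ {p} → p ∈ cs → ∀ {y} →
              y ∈ leavesC p → y ∈ onesL cs → y ∈ onesC p
onesL-child cs u i y∈ y1 with onesL⁻ cs y1
... | q , j , yq with sharedLeaf cs u i j y∈ (onesC⊆leavesC q yq)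
... | refl = yq

XT-inside : ∀ cs → Unique (leavesL cs) → ∀ {p} → p ∈ cs → ∀ {x y} →
            x ∈ leavesC p → y ∈ leavesC p → XT (node cs) x y → XT (proj₂ p) x y
XT-inside cs u i x∈ y∈ h with XT⇒XAt cs h
... | inj₁ (q , j , h') with sharedLeaf cs u i j y∈ (target∈leaves (proj₂ q) h')
... | refl = h'
XT-inside cs u i x∈ y∈ h | inj₂ (_ , q , j , yq , x∉) with sharedLeaf cs u i j y∈ (onesC⊆leavesC q yq)
... | refl = ⊥-elim (x∉ x∈)

mutual
  zerosT : Tree → List ℕ
  zerosT (leaf x) = x ∷ []
  zerosT (node cs) = zerosL cs

  zerosL : Children → List ℕ
  zerosL [] = []
  zerosL ((b , c) ∷ cs) = (if b then [] else zerosT c) ++ zerosL cs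

zerosL⁺ : ∀ cs {p} → p ∈ cs → proj₁ p ≡ false → zerosT (proj₂ p) ⊆ zerosL cs
zerosL⁺ ((false , c) ∷ cs) (here refl) refl i = ∈-++⁺ˡ i
zerosL⁺ ((true , c) ∷ cs) (here refl) () i
zerosL⁺ ((b , c) ∷ cs) (there k) e i = ∈-++⁺ʳ (if b then [] else zerosT c) (zerosL⁺ cs k e i)

zerosL⁻ : ∀ cs {z} → z ∈ zerosL cs →
          Σ (Bool × Tree) (λ p → p ∈ cs × (proj₁ p ≡ false) × z ∈ zerosT (proj₂ p))
zerosL⁻ ((true , c) ∷ cs) i with zerosL⁻ cs i
... | p , k , e , l = p , there k , e , l
zerosL⁻ ((false , c) ∷ cs) i with ∈-++⁻ (zerosT c) i
... | inj₁ j = (false , c) , here refl , refl , j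
... | inj₂ j with zerosL⁻ cs j
... | p , k , e , l = p , there k , e , l

mutual
  zeros⊆leaves : ∀ t → zerosT t ⊆ leavesT t
  zeros⊆leaves (leaf x) i = i
  zeros⊆leaves (node cs) i = zerosL⊆leavesL cs i

  zerosL⊆leavesL : ∀ cs → zerosL cs ⊆ leavesL cs
  zerosL⊆leavesL ((true , c) ∷ cs) i = ∈-++⁺ʳ (leavesT c) (zerosL⊆leavesL cs i)
  zerosL⊆leavesL ((false , c) ∷ cs) i with ∈-++⁻ (zerosT c) i
  ... | inj₁ j = ∈-++⁺ˡ (zeros⊆leaves c j)
  ... | inj₂ j = ∈-++⁺ʳ (leavesT c) (zerosL⊆leavesL cs j)

mutual
  ones-zeros-disjoint : ∀ t → Unique (leavesT t) → ∀ {z} → z ∈ onesT t → z ∉ zerosT t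
  ones-zeros-disjoint (leaf x) u ()
  ones-zeros-disjoint (node cs) u i j = ones-zeros-disjointL cs u i j

  ones-zeros-disjointL : ∀ cs → Unique (leavesL cs) → ∀ {z} → z ∈ onesL cs → z ∉ zerosL cs
  ones-zeros-disjointL ((b , c) ∷ cs) u i j with Unique-++⁻ {leavesT c} u
  ... | uc , ucs , disj with b | ∈-++⁻ (onesC (b , c)) i
  ... | true | inj₁ k = disj k (zerosL⊆leavesL cs j)
  ... | true | inj₂ k = ones-zeros-disjointL cs ucs k j
  ... | false | inj₁ k with ∈-++⁻ (zerosT c) j
  ...   | inj₁ l = ones-zeros-disjoint c uc k l
  ...   | inj₂ l = disj (ones⊆leaves c k) (zerosL⊆leavesL cs l)
  ones-zeros-disjointL ((b , c) ∷ cs) u i j | uc , ucs , disj | false | inj₂ k with ∈-++⁻ (zerosT c) j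
  ...   | inj₁ l = disj (zeros⊆leaves c l) (onesL⊆leavesL cs k)
  ...   | inj₂ l = ones-zeros-disjointL cs ucs k l

mutual
  ones-zeros-cover : ∀ t {y} → y ∈ leavesT t → (y ∈ onesT t) ⊎ (y ∈ zerosT t)
  ones-zeros-cover (leaf x) i = inj₂ i
  ones-zeros-cover (node cs) i = ones-zeros-coverL cs i

  ones-zeros-coverL : ∀ cs {y} → y ∈ leavesL cs → (y ∈ onesL cs) ⊎ (y ∈ zerosL cs)
  ones-zeros-coverL ((b , c) ∷ cs) i with ∈-++⁻ (leavesT c) i
  ones-zeros-coverL ((true , c) ∷ cs) i | inj₁ j = inj₁ (∈-++⁺ˡ j)
  ones-zeros-coverL ((false , c) ∷ cs) i | inj₁ j with ones-zeros-cover c j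
  ... | inj₁ k = inj₁ (∈-++⁺ˡ k)
  ... | inj₂ k = inj₂ (∈-++⁺ˡ k)
  ones-zeros-coverL ((b , c) ∷ cs) i | inj₂ j with ones-zeros-coverL cs j
  ... | inj₁ k = inj₁ (∈-++⁺ʳ (onesC (b , c)) k)
  ... | inj₂ k = inj₂ (∈-++⁺ʳ (if b then [] else zerosT c) k)

zero-not-target : ∀ t → Unique (leavesT t) → ∀ {x z} → z ∈ zerosT t → ¬ XT t x z
zero-not-target t u z0 h = ones-zeros-disjoint t u (target∈ones t h) z0

ReducedEdge : Bool → Tree → Set
ReducedEdge b (leaf _) = ⊤
ReducedEdge b (node ds) = (b ≡ true) × Σ ℕ (λ z → z ∈ zerosL ds)

mutual
  Reduced : Tree → Set
  Reduced (leaf _) = ⊤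
  Reduced (node cs) = ReducedL cs

  ReducedL : Children → Set
  ReducedL [] = ⊤
  ReducedL ((b , c) ∷ cs) = ReducedEdge b c × Reduced c × ReducedL cs

ReducedC : Bool × Tree → Set
ReducedC p = ReducedEdge (proj₁ p) (proj₂ p) × Reduced (proj₂ p)

reducedChild : ∀ cs → ReducedL cs → ∀ {p} → p ∈ cs → ReducedC p
reducedChild ((b , c) ∷ cs) (e , r , rs) (here refl) = e , r
reducedChild ((b , c) ∷ cs) (e , r , rs) (there k) = reducedChild cs rs k

reducedChildren : ∀ cs → (∀ {p} → p ∈ cs → ReducedC p) → ReducedL cs
reducedChildren [] f = tt
reducedChildren ((b , c) ∷ cs) f = proj₁ (f (here refl)) , proj₂ (f (here refl)) , reducedChildren cs (λ k → f (there k))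

phyChild : ∀ cs → PhyL cs → ∀ {p} → p ∈ cs → PhyT (proj₂ p)
phyChild ((b , c) ∷ cs) (ph , phs) (here refl) = ph
phyChild ((b , c) ∷ cs) (ph , phs) (there k) = phyChild cs phs k

phyChildren : ∀ cs → (∀ {p} → p ∈ cs → PhyT (proj₂ p)) → PhyL cs
phyChildren [] f = tt
phyChildren ((b , c) ∷ cs) f = f (here refl) , phyChildren cs (λ k → f (there k))

_⊑_ : Tree → Tree → Set
t ⊑ t' = (leavesT t ≈ₗ leavesT t') × (onesT t ⊆ onesT t') × (∀ {x y} → XT t x y → XT t' x y)

-- Equivalent trees have the same leaves, one-leaves and relation X.  As children
-- they can replace each other without changing the relation of the parent.
Equiv : Tree → Tree → Set
Equiv t t' = (t ⊑ t') × (t' ⊑ t)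

_⊑C_ : Bool × Tree → Bool × Tree → Set
p ⊑C q = (leavesC p ≈ₗ leavesC q) × (onesC p ⊆ onesC q) × (∀ {x y} → XT (proj₂ p) x y → XT (proj₂ q) x y)

EquivC : Bool × Tree → Bool × Tree → Set
EquivC p q = (p ⊑C q) × (q ⊑C p)

Equiv-refl : ∀ {t} → Equiv t t
Equiv-refl = (≈ₗ-refl , (λ i → i) , (λ h → h)) , (≈ₗ-refl , (λ i → i) , (λ h → h))

Equiv-trans : ∀ {t t' t''} → Equiv t t' → Equiv t' t'' → Equiv t t''
Equiv-trans ((l , o , x) , (l' , o' , x')) ((m , p , y) , (m' , p' , y')) =
  (≈ₗ-trans l m , (λ i → p (o i)) , (λ h → y (x h))) , (≈ₗ-trans m' l' , (λ i → o' (p' i)) , (λ h → x' (y' h)))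

EquivC-refl : ∀ {p} → EquivC p p
EquivC-refl = (≈ₗ-refl , (λ i → i) , (λ h → h)) , (≈ₗ-refl , (λ i → i) , (λ h → h))

EquivC-trans : ∀ {p q r} → EquivC p q → EquivC q r → EquivC p r
EquivC-trans ((l , o , x) , (l' , o' , x')) ((m , p , y) , (m' , p' , y')) =
  (≈ₗ-trans l m , (λ i → p (o i)) , (λ h → y (x h))) , (≈ₗ-trans m' l' , (λ i → o' (p' i)) , (λ h → x' (y' h)))

Equiv⇒EquivC : ∀ b {c c'} → Equiv c c' → EquivC (b , c) (b , c')
Equiv⇒EquivC true ((l , _ , x) , (l' , _ , x')) = (l , proj₁ l , x) , (l' , proj₁ l' , x')
Equiv⇒EquivC false ((l , o , x) , (l' , o' , x')) = (l , o , x) , (l' , o' , x')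

node-⊑ : ∀ cs ds →
         (∀ {p} → p ∈ cs → Σ (Bool × Tree) (λ q → q ∈ ds × p ⊑C q)) →
         (∀ {q} → q ∈ ds → Σ (Bool × Tree) (λ p → p ∈ cs × leavesC q ⊆ leavesC p)) →
         node cs ⊑ node ds
node-⊑ cs ds match back = (leaves⊆ , leaves⊇) , ones⊆ , X⊆
  where
  leaves⊆ : leavesL cs ⊆ leavesL ds
  leaves⊆ i with leavesL⁻ cs i
  ... | p , k , l with match k
  ... | q , j , (ls , _) = leavesL⁺ ds j (proj₁ ls l)
  leaves⊇ : leavesL ds ⊆ leavesL cs
  leaves⊇ i with leavesL⁻ ds i
  ... | q , k , l with back k
  ... | p , j , s = leavesL⁺ cs j (s l)
  ones⊆ : onesL cs ⊆ onesL ds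
  ones⊆ i with onesL⁻ cs i
  ... | p , k , l with match k
  ... | q , j , (_ , os , _) = onesL⁺ ds j (os l)
  X⊆ : ∀ {x y} → XT (node cs) x y → XT (node ds) x y
  X⊆ h with XT⇒XAt cs h
  ... | inj₁ (p , i , h') with match i
  ... | q , j , (_ , _ , xs) = XT-below ds j (xs h')
  X⊆ h | inj₂ (x∈ , p , i , y∈ , x∉) with match i
  ... | q , j , (ls , os , _) = XT-at ds j (leaves⊆ x∈) (λ z → x∉ (proj₂ ls z)) (os y∈)

Pointwise-∈ : ∀ {cs ds} → Pointwise EquivC cs ds → ∀ {p} → p ∈ cs → Σ (Bool × Tree) (λ q → q ∈ ds × EquivC p q)
Pointwise-∈ (r ∷ rs) (here refl) = _ , here refl , r
Pointwise-∈ (r ∷ rs) (there i) with Pointwise-∈ rs i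
... | q , j , r' = q , there j , r'

Pointwise-∈⁻ : ∀ {cs ds} → Pointwise EquivC cs ds → ∀ {q} → q ∈ ds → Σ (Bool × Tree) (λ p → p ∈ cs × EquivC p q)
Pointwise-∈⁻ (r ∷ rs) (here refl) = _ , here refl , r
Pointwise-∈⁻ (r ∷ rs) (there i) with Pointwise-∈⁻ rs i
... | p , j , r' = p , there j , r'

childwise : ∀ {cs ds} → Pointwise EquivC cs ds → Equiv (node cs) (node ds)
childwise {cs} {ds} P =
  node-⊑ cs ds (λ i → forth i) (λ j → back j) , node-⊑ ds cs (λ j → back' j) (λ i → forth' i)
  where
  forth : ∀ {p} → p ∈ cs → Σ (Bool × Tree) (λ q → q ∈ ds × p ⊑C q)
  forth i with Pointwise-∈ P i
  ... | q , j , (s , _) = q , j , s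
  forth' : ∀ {p} → p ∈ cs → Σ (Bool × Tree) (λ q → q ∈ ds × leavesC p ⊆ leavesC q)
  forth' i with Pointwise-∈ P i
  ... | q , j , ((ls , _) , _) = q , j , proj₁ ls
  back : ∀ {q} → q ∈ ds → Σ (Bool × Tree) (λ p → p ∈ cs × leavesC q ⊆ leavesC p)
  back j with Pointwise-∈⁻ P j
  ... | p , i , ((ls , _) , _) = p , i , proj₂ ls
  back' : ∀ {q} → q ∈ ds → Σ (Bool × Tree) (λ p → p ∈ cs × q ⊑C p)
  back' j with Pointwise-∈⁻ P j
  ... | p , i , (_ , s) = p , i , s

replaceChild : ∀ pre post {p q} → EquivC p q → Equiv (node (pre ++ p ∷ post)) (node (pre ++ q ∷ post))
replaceChild pre post r =
  childwise (Pointwise.++⁺ (Pointwise.refl EquivC-refl {pre}) (r ∷ Pointwise.refl EquivC-refl {post}))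

replaceBlock : ∀ pre post {ds es} → Pointwise EquivC ds es → Equiv (node (pre ++ ds ++ post)) (node (pre ++ es ++ post))
replaceBlock pre post r =
  childwise (Pointwise.++⁺ (Pointwise.refl EquivC-refl {pre}) (Pointwise.++⁺ r (Pointwise.refl EquivC-refl {post})))

-- An inner edge (u, w) can be contracted without changing X when it is a 0-edge
-- or w has no zero leaf: then the one-leaves of w seen from u are exactly the
-- one-leaves of w.
Contractible : Bool → Children → Set
Contractible b ds = (b ≡ false) ⊎ (∀ {z} → z ∉ zerosL ds)

onesC-contractible : ∀ b ds → Contractible b ds → onesC (b , node ds) ⊆ onesL ds
onesC-contractible false ds _ i = i
onesC-contractible true ds (inj₁ ()) i
onesC-contractible true ds (inj₂ nz) i with ones-zeros-coverL ds i
... | inj₁ k = k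
... | inj₂ k = ⊥-elim (nz k)

onesL⊆onesC : ∀ b ds → onesL ds ⊆ onesC (b , node ds)
onesL⊆onesC true ds i = onesL⊆leavesL ds i
onesL⊆onesC false ds i = i

leavesL-contract : ∀ pre b ds post → leavesL (pre ++ ds ++ post) ≡ leavesL (pre ++ (b , node ds) ∷ post)
leavesL-contract pre b ds post = begin
  leavesL (pre ++ ds ++ post)                  ≡⟨ leavesL-++ pre (ds ++ post) ⟩
  leavesL pre ++ leavesL (ds ++ post)          ≡⟨ cong (leavesL pre ++_) (leavesL-++ ds post) ⟩
  leavesL pre ++ leavesL ds ++ leavesL post    ≡⟨ sym (leavesL-++ pre ((b , node ds) ∷ post)) ⟩
  leavesL (pre ++ (b , node ds) ∷ post)        ∎
  where open ≡-Reasoning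

contractEdge-⊒ : ∀ pre b ds post → node (pre ++ ds ++ post) ⊑ node (pre ++ (b , node ds) ∷ post)
contractEdge-⊒ pre b ds post = ≈ₗ-reflexive L≡ , ones⊇ , X⊇
  where
  cs₁ cs₂ : Children
  cs₁ = pre ++ (b , node ds) ∷ post
  cs₂ = pre ++ ds ++ post
  L≡ : leavesL cs₂ ≡ leavesL cs₁
  L≡ = leavesL-contract pre b ds post

  ones⊇ : onesL cs₂ ⊆ onesL cs₁
  ones⊇ i with onesL⁻ cs₂ i
  ... | p , k , y∈ with ∈-insert⁻ pre k
  ... | inj₁ k' = onesL⁺ cs₁ (∈-insert⁺ pre k') y∈
  ... | inj₂ k' = onesL⁺ cs₁ (∈-spliced pre) (onesL⊆onesC b ds (onesL⁺ ds k' y∈))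

  X⊇ : ∀ {x y} → XT (node cs₂) x y → XT (node cs₁) x y
  X⊇ h with XT⇒XAt cs₂ h
  ... | inj₁ (p , i , h') with ∈-insert⁻ pre i
  ... | inj₁ k = XT-below cs₁ (∈-insert⁺ pre k) h'
  ... | inj₂ k = XT-below cs₁ (∈-spliced pre) (XT-below ds k h')
  X⊇ {x} h | inj₂ (x∈ , p , i , y∈ , x∉) with ∈-insert⁻ pre i
  ... | inj₁ k = XT-at cs₁ (∈-insert⁺ pre k) (subst (x ∈_) L≡ x∈) x∉ y∈
  ... | inj₂ k with x ∈? leavesL ds
  ... | yes x∈ds = XT-below cs₁ (∈-spliced pre) (XT-at ds k x∈ds x∉ y∈)
  ... | no x∉ds = XT-at cs₁ (∈-spliced pre) (subst (x ∈_) L≡ x∈) x∉ds (onesL⊆onesC b ds (onesL⁺ ds k y∈))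

contractEdge-⊑ : ∀ pre b ds post → Contractible b ds → node (pre ++ (b , node ds) ∷ post) ⊑ node (pre ++ ds ++ post)
contractEdge-⊑ pre b ds post cb = ≈ₗ-reflexive (sym L≡) , ones⊆ , X⊆
  where
  cs₁ cs₂ : Children
  cs₁ = pre ++ (b , node ds) ∷ post
  cs₂ = pre ++ ds ++ post
  L≡ : leavesL cs₂ ≡ leavesL cs₁
  L≡ = leavesL-contract pre b ds post
  to₂ : leavesL cs₁ ⊆ leavesL cs₂
  to₂ {x} = subst (x ∈_) (sym L≡)

  ones⊆ : onesL cs₁ ⊆ onesL cs₂
  ones⊆ i with onesL⁻ cs₁ i
  ... | p , k , y∈ with ∈-splice⁻ pre k
  ... | inj₁ k' = onesL⁺ cs₂ (∈-insert⁺ pre k') y∈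
  ... | inj₂ refl with onesL⁻ ds (onesC-contractible b ds cb y∈)
  ... | q , j , yq = onesL⁺ cs₂ (∈-inserted pre j) yq

  X⊆ : ∀ {x y} → XT (node cs₁) x y → XT (node cs₂) x y
  X⊆ h with XT⇒XAt cs₁ h
  ... | inj₁ (p , i , h') with ∈-splice⁻ pre i
  ... | inj₁ k = XT-below cs₂ (∈-insert⁺ pre k) h'
  ... | inj₂ refl with XT⇒XAt ds h'
  ... | inj₁ (q , j , h'') = XT-below cs₂ (∈-inserted pre j) h''
  ... | inj₂ (x∈ , q , j , y∈ , x∉) =
    XT-at cs₂ (∈-inserted pre j) (to₂ (leavesL⁺ cs₁ (∈-spliced pre) x∈)) x∉ y∈
  X⊆ h | inj₂ (x∈ , p , i , y∈ , x∉) with ∈-splice⁻ pre i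
  ... | inj₁ k = XT-at cs₂ (∈-insert⁺ pre k) (to₂ x∈) x∉ y∈
  ... | inj₂ refl with onesL⁻ ds (onesC-contractible b ds cb y∈)
  ... | q , j , yq = XT-at cs₂ (∈-inserted pre j) (to₂ x∈) (λ xq → x∉ (leavesL⁺ ds j xq)) yq

contractEdge : ∀ pre b ds post → Contractible b ds →
               Equiv (node (pre ++ (b , node ds) ∷ post)) (node (pre ++ ds ++ post))
contractEdge pre b ds post cb = contractEdge-⊑ pre b ds post cb , contractEdge-⊒ pre b ds post

explains-Equiv : ∀ {L X t t'} → Equiv t t' → Explains L X t → Explains L X t'
explains-Equiv ((ls , _ , x⊆) , (_ , _ , x⊇)) (eL , eX) =
  (λ x → mk⇔ (λ h → proj₁ ls (Equivalence.to (eL x) h)) (λ h → Equivalence.from (eL x) (proj₂ ls h))) ,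
  (λ x y → mk⇔ (λ h → x⊆ (Equivalence.to (eX x y) h)) (λ h → Equivalence.from (eX x y) (x⊇ h)))

-- An extended contraction of t explaining the same relation, whose result has
-- at least two children at the root (so that no root fix-up takes place).
EquivContraction : Tree → Set
EquivContraction t = Σ Children (λ cs' → ContrStep t (node cs') × Equiv t (node cs') × (2 ≤ length cs'))

fixChild-id : ∀ b cs → 2 ≤ length cs → fixChild b (node cs) ≡ (b , node cs)
fixChild-id b (x ∷ y ∷ cs) _ = refl
fixChild-id b (x ∷ []) (s≤s ())

fixRoot-id : ∀ cs → 2 ≤ length cs → fixRoot (node cs) ≡ node cs
fixRoot-id (x ∷ y ∷ cs) _ = refl
fixRoot-id (x ∷ []) (s≤s ())

length-inserted : ∀ {A : Set} (pre ds post : List A) → length ds ≤ length (pre ++ ds ++ post)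
length-inserted pre ds post = begin
  length ds                               ≤⟨ m≤m+n (length ds) (length post) ⟩
  length ds + length post                 ≡⟨ sym (length-++ ds) ⟩
  length (ds ++ post)                     ≤⟨ m≤n+m (length (ds ++ post)) (length pre) ⟩
  length pre + length (ds ++ post)        ≡⟨ sym (length-++ pre) ⟩
  length (pre ++ ds ++ post)              ∎
  where open ≤-Reasoning

length-spliced : ∀ {A : Set} (pre : List A) {x y post} → length (pre ++ x ∷ post) ≡ length (pre ++ y ∷ post)
length-spliced pre = trans (length-++ pre) (sym (length-++ pre))

contractInner : ∀ pre b ds post → Contractible b ds → 2 ≤ length ds →
                EquivContraction (node (pre ++ (b , node ds) ∷ post))
contractInner pre b ds post cb l =
  pre ++ ds ++ post , inner pre b ds post , contractEdge pre b ds post cb ,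
  ≤-trans l (length-inserted pre ds post)

contractDeeper : ∀ pre b ds post → 2 ≤ length (pre ++ (b , node ds) ∷ post) →
                 EquivContraction (node ds) → EquivContraction (node (pre ++ (b , node ds) ∷ post))
contractDeeper pre b ds post l (cs' , st , eq , l') =
  pre ++ (b , node cs') ∷ post ,
  subst (λ q → ContrStep _ (node (pre ++ q ∷ post))) (fixChild-id b cs' l') (deep pre b post st) ,
  replaceChild pre post (Equiv⇒EquivC b eq) ,
  subst (2 ≤_) (length-spliced pre) l

-- Scanning the children of a phylogenetic tree: either every edge satisfies
-- the reducedness condition, or the first one that does not can be contracted
-- (a 0-edge, or an edge into a vertex without zero leaf), possibly deep inside.
mutual
  reducedOrContractible : ∀ t → PhyT t → Reduced t ⊎ EquivContraction t
  reducedOrContractible (leaf x) _ = inj₁ tt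
  reducedOrContractible (node cs) (l , ph) = scan [] cs refl l ph

  scan : ∀ {cs} pre post → cs ≡ pre ++ post → 2 ≤ length cs → PhyL post →
         ReducedL post ⊎ EquivContraction (node cs)
  scan pre [] e l ph = inj₁ tt
  scan pre ((b , leaf x) ∷ post) e l (_ , ph)
    with scan (pre ++ [ (b , leaf x) ]) post (trans e (sym (++-assoc pre [ (b , leaf x) ] post))) l ph
  ... | inj₁ r = inj₁ (tt , tt , r)
  ... | inj₂ c = inj₂ c
  scan pre ((false , node ds) ∷ post) refl l (phd , ph) = inj₂ (contractInner pre false ds post (inj₁ refl) (proj₁ phd))
  scan pre ((true , node ds) ∷ post) refl l (phd , ph) with zerosL ds in zs
  ... | [] = inj₂ (contractInner pre true ds post (inj₂ (λ i → ¬Any[] (subst (_ ∈_) zs i))) (proj₁ phd))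
  ... | z ∷ _ with reducedOrContractible (node ds) phd
  ... | inj₂ c = inj₂ (contractDeeper pre true ds post l c)
  ... | inj₁ rd with scan (pre ++ [ (true , node ds) ]) post (sym (++-assoc pre [ (true , node ds) ] post)) l ph
  ...   | inj₁ r = inj₁ ((refl , z , here refl) , rd , r)
  ...   | inj₂ c = inj₂ c

leastResolved⇒reduced : ∀ L X T → PhyT T → LeastResolved L X T → Reduced T
leastResolved⇒reduced L X T ph (expl , minimal) with reducedOrContractible T ph
... | inj₁ r = r
... | inj₂ (cs' , st , eq , l) =
  ⊥-elim (minimal (node cs') (node cs' , st , sym (fixRoot-id cs' l)) (explains-Equiv eq expl))

Proper : Tree → Set
Proper t = PhyT t × Reduced t × Unique (leavesT t)

SameX : Tree → Tree → Set
SameX t t' = (leavesT t ≈ₗ leavesT t') × (∀ {x y} → XT t x y → XT t' x y) × (∀ {x y} → XT t' x y → XT t x y)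

SameX-sym : ∀ {t t'} → SameX t t' → SameX t' t
SameX-sym ((f , g) , x⊆ , x⊇) = (g , f) , x⊇ , x⊆

Equiv⇒SameX : ∀ {t t'} → Equiv t t' → SameX t t'
Equiv⇒SameX ((ls , _ , x⊆) , (_ , _ , x⊇)) = ls , x⊆ , x⊇

explains⇒SameX : ∀ {L X t t'} → Explains L X t → Explains L X t' → SameX t t'
explains⇒SameX (eL , eX) (eL' , eX') =
  ((λ {x} i → Equivalence.to (eL' x) (Equivalence.from (eL x) i)) ,
   (λ {x} i → Equivalence.to (eL x) (Equivalence.from (eL' x) i))) ,
  (λ {x} {y} h → Equivalence.to (eX' x y) (Equivalence.from (eX x y) h)) ,
  (λ {x} {y} h → Equivalence.to (eX x y) (Equivalence.from (eX' x y) h))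

someLeaf : ∀ t → PhyT t → Σ ℕ (λ x → x ∈ leavesT t)
someLeaf (leaf x) _ = x , here refl
someLeaf (node ((b , c) ∷ cs)) (_ , phc , _) with someLeaf c phc
... | x , i = x , ∈-++⁺ˡ i

leafOutside : ∀ cs → PhyT (node cs) → Unique (leavesL cs) → ∀ {p} → p ∈ cs →
              Σ ℕ (λ x → x ∈ leavesL cs × x ∉ leavesC p)
leafOutside (_ ∷ []) (s≤s () , _) u _
leafOutside ((b , c) ∷ (b' , c') ∷ cs) (_ , _ , phc' , _) u (here refl) with someLeaf c' phc'
... | y , y∈ = y , ∈-++⁺ʳ (leavesT c) (∈-++⁺ˡ y∈) ,
               λ yc → proj₂ (proj₂ (Unique-++⁻ {leavesT c} u)) yc (∈-++⁺ˡ y∈)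
leafOutside ((b , c) ∷ (b' , c') ∷ cs) (_ , phc , _) u (there k) with someLeaf c phc
... | y , y∈ = y , ∈-++⁺ˡ y∈ ,
               λ yp → proj₂ (proj₂ (Unique-++⁻ {leavesT c} u)) y∈ (leavesL⁺ ((b' , c') ∷ cs) k yp)

notSingleton : ∀ cs → PhyT (node cs) → Unique (leavesL cs) → ∀ a → ¬ (leavesL cs ⊆ (a ∷ []))
notSingleton ((b , c) ∷ cs) ph u a sub with leafOutside ((b , c) ∷ cs) ph u (here refl)
                                        | someLeaf c (proj₁ (proj₂ ph))
... | y , y∈ , y∉ | x , x∈ with sub y∈ | sub (∈-++⁺ˡ x∈)
... | here refl | here refl = y∉ x∈

SameChild : Children → ℕ → ℕ → Set
SameChild cs x y = Σ (Bool × Tree) (λ p → p ∈ cs × x ∈ leavesC p × y ∈ leavesC p)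

-- SameChild expressed through X alone: x = y, or some X-target z is X-related
-- from neither x nor y (z will be a zero leaf of the common child).
XSibling : Tree → ℕ → ℕ → Set
XSibling t x y = x ≡ y ⊎ Σ ℕ (λ z → Σ ℕ (λ w → XT t w z) × (x ≡ z ⊎ ¬ XT t x z) × (y ≡ z ⊎ ¬ XT t y z))

sameChild⇒XSibling : ∀ cs → Proper (node cs) → ∀ {x y} → SameChild cs x y → XSibling (node cs) x y
sameChild⇒XSibling cs (ph , r , u) ((b , leaf a) , i , here refl , here refl) = inj₁ refl
sameChild⇒XSibling cs (ph , r , u) ((b , node ds) , i , x∈ , y∈) with reducedChild cs r i
... | (refl , z , z0) , _ with leafOutside cs ph u i
... | w , w∈ , w∉ =
  inj₂ (z , (w , XT-at cs i w∈ w∉ (zerosL⊆leavesL ds z0)) , inj₂ (notToZero x∈) , inj₂ (notToZero y∈))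
  where
  notToZero : ∀ {a} → a ∈ leavesL ds → ¬ XT (node cs) a z
  notToZero a∈ h = zero-not-target (node ds) (uniqueChild cs u i) z0
                     (XT-inside cs u i a∈ (zerosL⊆leavesL ds z0) h)

XSibling⇒sameChild : ∀ cs → Unique (leavesL cs) → ∀ {x y} → x ∈ leavesL cs → y ∈ leavesL cs →
                     XSibling (node cs) x y → SameChild cs x y
XSibling⇒sameChild cs u x∈ y∈ (inj₁ refl) with leavesL⁻ cs x∈
... | p , i , xp = p , i , xp , xp
XSibling⇒sameChild cs u x∈ y∈ (inj₂ (z , (w , h) , cx , cy)) with leavesL⁻ cs (target∈leaves (node cs) h)
... | p , i , zp = p , i , inChild cx x∈ , inChild cy y∈
  where
  z1 : z ∈ onesC p
  z1 = onesL-child cs u i zp (target∈ones (node cs) h)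
  inChild : ∀ {a} → (a ≡ z ⊎ ¬ XT (node cs) a z) → a ∈ leavesL cs → a ∈ leavesC p
  inChild (inj₁ refl) _ = zp
  inChild {a} (inj₂ nx) a∈ with a ∈? leavesC p
  ... | yes ap = ap
  ... | no a∉ = ⊥-elim (nx (XT-at cs i a∈ a∉ z1))

XSibling-transfer : ∀ {t₁ t₂} → SameX t₁ t₂ → ∀ {x y} → XSibling t₁ x y → XSibling t₂ x y
XSibling-transfer S (inj₁ e) = inj₁ e
XSibling-transfer (_ , x⊆ , x⊇) (inj₂ (z , (w , h) , cx , cy)) = inj₂ (z , (w , x⊆ h) , tr cx , tr cy)
  where
  tr : ∀ {a} → (a ≡ _ ⊎ ¬ XT _ a z) → (a ≡ _ ⊎ ¬ XT _ a z)
  tr (inj₁ e) = inj₁ e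
  tr (inj₂ n) = inj₂ (λ h' → n (x⊇ h'))

childLeaves⊆ : ∀ cs ds → Proper (node cs) → Unique (leavesL ds) → SameX (node cs) (node ds) →
               ∀ {p q a} → p ∈ cs → q ∈ ds → a ∈ leavesC p → a ∈ leavesC q → leavesC p ⊆ leavesC q
childLeaves⊆ cs ds P₁ u₂ S@((ls , _) , _) {p} i j ap aq xp
  with XSibling⇒sameChild ds u₂ (ls (leavesL⁺ cs i xp)) (ls (leavesL⁺ cs i ap))
         (XSibling-transfer S (sameChild⇒XSibling cs P₁ (p , i , xp , ap)))
... | r , k , xr , ar with sharedLeaf ds u₂ k j ar aq
... | refl = xr

childX⊆ : ∀ cs ds → Unique (leavesL ds) → (∀ {x y} → XT (node cs) x y → XT (node ds) x y) →
          ∀ {p q} → p ∈ cs → q ∈ ds → leavesC p ⊆ leavesC q →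
          ∀ {x y} → XT (proj₂ p) x y → XT (proj₂ q) x y
childX⊆ cs ds u₂ x⊆ {p} i j sub h =
  XT-inside ds u₂ j (sub (source∈leaves (proj₂ p) h)) (sub (target∈leaves (proj₂ p) h)) (x⊆ (XT-below cs i h))

leafLabel : ∀ cs ds → PhyT (node cs) → Unique (leavesL cs) → Unique (leavesL ds) →
            (∀ {x y} → XT (node cs) x y → XT (node ds) x y) →
            ∀ {a b} → (true , leaf a) ∈ cs → (b , leaf a) ∈ ds → b ≡ true
leafLabel cs ds ph u₁ u₂ x⊆ {a} {b} i j with leafOutside cs ph u₁ i
... | x , x∈ , x∉ = label b (onesL-child ds u₂ j (here refl) (target∈ones (node ds) (x⊆ (XT-at cs i x∈ x∉ (here refl)))))
  where
  label : ∀ b → a ∈ onesC (b , leaf a) → b ≡ true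
  label true _ = refl

ChildIso : Bool × Tree → Bool × Tree → Set
ChildIso p q = (proj₁ p ≡ proj₁ q) × (proj₂ p ≅ proj₂ q)

mutual
  ≅-refl : ∀ t → t ≅ t
  ≅-refl (leaf x) = leaf≅
  ≅-refl (node cs) = node≅ (Permutation.refl (≅-reflL cs))

  ≅-reflL : ∀ cs → Pointwise ChildIso cs cs
  ≅-reflL [] = []
  ≅-reflL ((b , c) ∷ cs) = (refl , ≅-refl c) ∷ ≅-reflL cs

ChildIso-refl : ∀ p → ChildIso p p
ChildIso-refl (b , c) = refl , ≅-refl c

Perm-refl : ∀ xs → Permutation ChildIso xs xs
Perm-refl xs = Permutation.refl (≅-reflL xs)

shift : ∀ {x y} d1 d2 → ChildIso x y → Permutation ChildIso (x ∷ d1 ++ d2) (d1 ++ y ∷ d2)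
shift [] d2 r = Permutation.prep r (Perm-refl d2)
shift {x} (d ∷ d1) d2 r =
  Permutation.trans (Permutation.swap (ChildIso-refl x) (ChildIso-refl d) (Perm-refl (d1 ++ d2)))
                    (Permutation.prep (ChildIso-refl d) (shift d1 d2 r))

leavesL-remove⁻ : ∀ d1 q d2 {x} → x ∈ leavesL (d1 ++ q ∷ d2) → (x ∈ leavesL (d1 ++ d2)) ⊎ (x ∈ leavesC q)
leavesL-remove⁻ d1 q d2 i with leavesL⁻ (d1 ++ q ∷ d2) i
... | p , k , l with ∈-splice⁻ d1 k
... | inj₁ k' = inj₁ (leavesL⁺ (d1 ++ d2) k' l)
... | inj₂ refl = inj₂ l

leavesL-remove⁺ : ∀ d1 q d2 → leavesL (d1 ++ d2) ⊆ leavesL (d1 ++ q ∷ d2)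
leavesL-remove⁺ d1 q d2 i with leavesL⁻ (d1 ++ d2) i
... | p , k , l = leavesL⁺ (d1 ++ q ∷ d2) (∈-insert⁺ d1 k) l

Unique-remove : ∀ d1 q d2 → Unique (leavesL (d1 ++ q ∷ d2)) →
                Unique (leavesL (d1 ++ d2)) × (∀ {x} → x ∈ leavesC q → x ∉ leavesL (d1 ++ d2))
Unique-remove d1 q d2 u with Unique-++⁻ {leavesL d1} (subst Unique (leavesL-++ d1 (q ∷ d2)) u)
... | u₁ , u₂₃ , disj₁ with Unique-++⁻ {leavesC q} u₂₃
... | _ , u₃ , disjq =
  subst Unique (sym (leavesL-++ d1 d2)) (Unique-++⁺ u₁ u₃ (λ i j → disj₁ i (∈-++⁺ʳ (leavesC q) j))) ,
  λ {x} xq xr → outside xq (subst (x ∈_) (leavesL-++ d1 d2) xr)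
  where
  outside : ∀ {x} → x ∈ leavesC q → x ∉ leavesL d1 ++ leavesL d2
  outside xq xr with ∈-++⁻ (leavesL d1) xr
  ... | inj₁ j = disj₁ j (∈-++⁺ˡ xq)
  ... | inj₂ j = disjq xq j

Match : Children → Bool × Tree → Set
Match ds p = Σ (Bool × Tree) (λ q → q ∈ ds × ChildIso p q × (leavesC p ≈ₗ leavesC q))

HasLeaf : Bool × Tree → Set
HasLeaf p = Σ ℕ (λ x → x ∈ leavesC p)

matching⇒permutation : ∀ cs ds → All (Match ds) cs → All HasLeaf cs → (∀ {q} → q ∈ ds → HasLeaf q) →
                       Unique (leavesL cs) → Unique (leavesL ds) → leavesL cs ≈ₗ leavesL ds →
                       Permutation ChildIso cs ds
matching⇒permutation [] [] _ _ _ _ _ _ = Perm-refl []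
matching⇒permutation [] (q ∷ ds) _ _ leafy _ _ (_ , ls⊇) with leafy (here refl)
... | x , x∈ with ls⊇ (leavesL⁺ (q ∷ ds) (here refl) x∈)
... | ()
matching⇒permutation (p ∷ cs) ds ((q , qi , r , s⊆ , s⊇) ∷ M) ((a , a∈) ∷ leafy) leafy' u₁ u₂ (ls⊆ , ls⊇)
  with ∈-∃++ qi
... | d1 , d2 , refl =
  Permutation.trans (Permutation.prep (ChildIso-refl p) rest) (shift d1 d2 r)
  where
  apart : ∀ {x} → x ∈ leavesC p → x ∉ leavesL cs
  apart = proj₂ (proj₂ (Unique-++⁻ {leavesC p} u₁))
  removed : Unique (leavesL (d1 ++ d2)) × (∀ {x} → x ∈ leavesC q → x ∉ leavesL (d1 ++ d2))
  removed = Unique-remove d1 q d2 u₂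
  rematch : ∀ {p'} → p' ∈ cs → Match (d1 ++ q ∷ d2) p' → HasLeaf p' → Match (d1 ++ d2) p'
  rematch i (q' , qi' , r' , t⊆ , t⊇) (a' , a'∈) with ∈-splice⁻ d1 qi'
  ... | inj₁ k = q' , k , r' , t⊆ , t⊇
  ... | inj₂ refl = ⊥-elim (apart (s⊇ (t⊆ a'∈)) (leavesL⁺ cs i a'∈))
  rest : Permutation ChildIso cs (d1 ++ d2)
  rest = matching⇒permutation cs (d1 ++ d2)
           (tabulate (λ i → rematch i (lookup M i) (lookup leafy i)))
           leafy (λ k → leafy' (∈-insert⁺ d1 k))
           (proj₁ (proj₂ (Unique-++⁻ {leavesC p} u₁))) (proj₁ removed) (to , from)
    where
    to : leavesL cs ⊆ leavesL (d1 ++ d2)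
    to x∈ with leavesL-remove⁻ d1 q d2 (ls⊆ (∈-++⁺ʳ (leavesC p) x∈))
    ... | inj₁ j = j
    ... | inj₂ j = ⊥-elim (apart (s⊇ j) x∈)
    from : leavesL (d1 ++ d2) ⊆ leavesL cs
    from x∈ with ∈-++⁻ (leavesC p) (ls⊇ (leavesL-remove⁺ d1 q d2 x∈))
    ... | inj₂ j = j
    ... | inj₁ j = ⊥-elim (proj₂ removed (s⊆ j) x∈)

mutual
  reduced-unique : ∀ t₁ t₂ → Proper t₁ → Proper t₂ → SameX t₁ t₂ → t₁ ≅ t₂
  reduced-unique (leaf a) (leaf a') _ _ ((ls , _) , _) with ls (here refl)
  ... | here refl = leaf≅
  reduced-unique (leaf a) (node ds) _ (ph₂ , _ , u₂) ((_ , ls) , _) = ⊥-elim (notSingleton ds ph₂ u₂ a ls)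
  reduced-unique (node cs) (leaf a) (ph₁ , _ , u₁) _ ((ls , _) , _) = ⊥-elim (notSingleton cs ph₁ u₁ a ls)
  reduced-unique (node cs) (node ds) P₁@(ph₁ , _ , u₁) P₂@(ph₂ , _ , u₂) S@(ls , _) =
    node≅ (matching⇒permutation cs ds (matchChildren cs ds P₁ P₂ S cs (λ i → i))
             (tabulate (λ i → someLeaf _ (phyChild cs (proj₂ ph₁) i)))
             (λ j → someLeaf _ (phyChild ds (proj₂ ph₂) j)) u₁ u₂ ls)

  matchChildren : ∀ cs ds → Proper (node cs) → Proper (node ds) → SameX (node cs) (node ds) →
                  ∀ cs' → (∀ {p} → p ∈ cs' → p ∈ cs) → All (Match ds) cs'
  matchChildren cs ds P₁ P₂ S [] inc = []
  matchChildren cs ds P₁@(ph₁ , r₁ , u₁) P₂@(_ , r₂ , u₂) S@((ls , _) , _) ((b , c) ∷ cs') inc =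
    (q , j , matchedChild cs ds P₁ P₂ S b c (proj₁ q) (proj₂ q) i j (s⊆ , s⊇)
                          (reducedChild cs r₁ i) (reducedChild ds r₂ j) , s⊆ , s⊇)
    ∷ matchChildren cs ds P₁ P₂ S cs' (λ k → inc (there k))
    where
    i : (b , c) ∈ cs
    i = inc (here refl)
    a : Σ ℕ (λ x → x ∈ leavesT c)
    a = someLeaf c (phyChild cs (proj₂ ph₁) i)
    found : Σ (Bool × Tree) (λ q → q ∈ ds × proj₁ a ∈ leavesC q)
    found = leavesL⁻ ds (ls (leavesL⁺ cs i (proj₂ a)))
    q : Bool × Tree
    q = proj₁ found
    j : q ∈ ds
    j = proj₁ (proj₂ found)
    s⊆ : leavesT c ⊆ leavesC q
    s⊆ = childLeaves⊆ cs ds P₁ u₂ S i j (proj₂ a) (proj₂ (proj₂ found))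
    s⊇ : leavesC q ⊆ leavesT c
    s⊇ = childLeaves⊆ ds cs P₂ u₁ (SameX-sym S) j i (proj₂ (proj₂ found)) (proj₂ a)

  matchedChild : ∀ cs ds → Proper (node cs) → Proper (node ds) → SameX (node cs) (node ds) →
                 ∀ b c b' d → (b , c) ∈ cs → (b' , d) ∈ ds → leavesT c ≈ₗ leavesT d →
                 ReducedC (b , c) → ReducedC (b' , d) → ChildIso (b , c) (b' , d)
  matchedChild cs ds (ph₁ , _ , u₁) (ph₂ , _ , u₂) (_ , x⊆ , x⊇) b (leaf a) b' (leaf a') i j (ls , _) _ _
    with ls (here refl)
  ... | here refl = label b b' i j , leaf≅
    where
    label : ∀ b b' → (b , leaf a) ∈ cs → (b' , leaf a) ∈ ds → b ≡ b'
    label true true _ _ = refl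
    label false false _ _ = refl
    label true false i j = sym (leafLabel cs ds ph₁ u₁ u₂ x⊆ i j)
    label false true i j = leafLabel ds cs ph₂ u₂ u₁ x⊇ j i
  matchedChild cs ds _ (ph₂ , _ , u₂) _ b (leaf a) b' (node ds') i j (_ , ls) _ _ =
    ⊥-elim (notSingleton ds' (phyChild ds (proj₂ ph₂) j) (uniqueChild ds u₂ j) a ls)
  matchedChild cs ds (ph₁ , _ , u₁) _ _ b (node cs') b' (leaf a) i j (ls , _) _ _ =
    ⊥-elim (notSingleton cs' (phyChild cs (proj₂ ph₁) i) (uniqueChild cs u₁ i) a ls)
  matchedChild cs ds (ph₁ , _ , u₁) (ph₂ , _ , u₂) (_ , x⊆ , x⊇) .true (node cs') .true (node ds') i j ls
               ((refl , _) , rc) ((refl , _) , rd) =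
    refl , reduced-unique (node cs') (node ds')
             (phyChild cs (proj₂ ph₁) i , rc , uniqueChild cs u₁ i)
             (phyChild ds (proj₂ ph₂) j , rd , uniqueChild ds u₂ j)
             (ls , childX⊆ cs ds u₂ x⊆ i j (proj₁ ls) , childX⊆ ds cs u₁ x⊇ j i (proj₂ ls))

-- Isomorphic trees have the same zero leaves, and are phylogenetic and reduced
-- together (needed to read off properties of T - v from T' ≅ T - v).
length-perm : ∀ {cs ds : Children} → Permutation ChildIso cs ds → length cs ≡ length ds
length-perm (Permutation.refl pw) = Pointwise.Pointwise-length pw
length-perm (Permutation.prep _ P) = cong suc (length-perm P)
length-perm (Permutation.swap _ _ P) = cong (λ n → suc (suc n)) (length-perm P)
length-perm (Permutation.trans P Q) = trans (length-perm P) (length-perm Q)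

zeros-cons : ∀ {p q cs ds} → proj₁ p ≡ proj₁ q → zerosT (proj₂ p) ⊆ zerosT (proj₂ q) →
             zerosL cs ⊆ zerosL ds → zerosL (p ∷ cs) ⊆ zerosL (q ∷ ds)
zeros-cons {true , c} refl zs zss i = zss i
zeros-cons {false , c} {_ , c'} refl zs zss i with ∈-++⁻ (zerosT c) i
... | inj₁ j = ∈-++⁺ˡ (zs j)
... | inj₂ j = ∈-++⁺ʳ (zerosT c') (zss j)

zeros-swap : ∀ {p q cs} → zerosL (p ∷ q ∷ cs) ⊆ zerosL (q ∷ p ∷ cs)
zeros-swap {p} {q} {cs} i with zerosL⁻ (p ∷ q ∷ cs) i
... | _ , here refl , e , z∈ = zerosL⁺ (q ∷ p ∷ cs) (there (here refl)) e z∈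
... | _ , there (here refl) , e , z∈ = zerosL⁺ (q ∷ p ∷ cs) (here refl) e z∈
... | _ , there (there k) , e , z∈ = zerosL⁺ (q ∷ p ∷ cs) (there (there k)) e z∈

mutual
  zeros≅ : ∀ {t t'} → t ≅ t' → zerosT t ⊆ zerosT t'
  zeros≅ leaf≅ i = i
  zeros≅ (node≅ P) i = zerosPerm P i

  zerosPerm : ∀ {cs ds} → Permutation ChildIso cs ds → zerosL cs ⊆ zerosL ds
  zerosPerm (Permutation.refl pw) i = zerosPointwise pw i
  zerosPerm (Permutation.prep {xs} {ys} {x} {y} (e , s) P) i = zeros-cons {x} {y} {xs} {ys} e (zeros≅ s) (zerosPerm P) i
  zerosPerm (Permutation.swap {xs} {ys} {x} {y} {x′} {y′} (e₁ , s₁) (e₂ , s₂) P) i =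
    zeros-swap {x′} {y′} {ys}
      (zeros-cons {x} {x′} {y ∷ xs} {y′ ∷ ys} e₁ (zeros≅ s₁)
        (zeros-cons {y} {y′} {xs} {ys} e₂ (zeros≅ s₂) (zerosPerm P)) i)
  zerosPerm (Permutation.trans P Q) i = zerosPerm Q (zerosPerm P i)

  zerosPointwise : ∀ {cs ds} → Pointwise ChildIso cs ds → zerosL cs ⊆ zerosL ds
  zerosPointwise {p ∷ cs} {q ∷ ds} ((e , s) ∷ pw) i = zeros-cons {p} {q} {cs} {ds} e (zeros≅ s) (zerosPointwise pw) i

reducedEdge≅ : ∀ {b b' c c'} → b ≡ b' → c ≅ c' → ReducedEdge b c → ReducedEdge b' c'
reducedEdge≅ refl leaf≅ r = tt
reducedEdge≅ refl (node≅ P) (e , z , z∈) = e , z , zerosPerm P z∈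

GoodC : Bool × Tree → Set
GoodC p = PhyT (proj₂ p) × ReducedC p

mutual
  good≅ : ∀ {t t'} → t ≅ t' → PhyT t × Reduced t → PhyT t' × Reduced t'
  good≅ leaf≅ g = g
  good≅ {node cs} {node ds} (node≅ P) ((l , ph) , r) =
    (subst (2 ≤_) (length-perm P) l , phyChildren ds (λ j → proj₁ (lookup goods j))) ,
    reducedChildren ds (λ j → proj₂ (lookup goods j))
    where
    goods : All GoodC ds
    goods = goodPerm P (tabulate (λ i → phyChild cs ph i , reducedChild cs r i))

  goodC≅ : ∀ {p q} → ChildIso p q → GoodC p → GoodC q
  goodC≅ (e , s) (ph , re , r) with good≅ s (ph , r)
  ... | ph' , r' = ph' , reducedEdge≅ e s re , r'

  goodPerm : ∀ {cs ds} → Permutation ChildIso cs ds → All GoodC cs → All GoodC ds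
  goodPerm (Permutation.refl pw) gs = goodPointwise pw gs
  goodPerm (Permutation.prep r P) (g ∷ gs) = goodC≅ r g ∷ goodPerm P gs
  goodPerm (Permutation.swap r₁ r₂ P) (g₁ ∷ g₂ ∷ gs) = goodC≅ r₂ g₂ ∷ goodC≅ r₁ g₁ ∷ goodPerm P gs
  goodPerm (Permutation.trans P Q) gs = goodPerm Q (goodPerm P gs)

  goodPointwise : ∀ {cs ds} → Pointwise ChildIso cs ds → All GoodC cs → All GoodC ds
  goodPointwise [] [] = []
  goodPointwise (r ∷ pw) (g ∷ gs) = goodC≅ r g ∷ goodPointwise pw gs

≈ₗ-++[] : ∀ (xs : List ℕ) → (xs ++ []) ≈ₗ xs
≈ₗ-++[] xs = ≈ₗ-reflexive (++-identityʳ xs)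

≈ₗ-sym : ∀ {xs ys} → xs ≈ₗ ys → ys ≈ₗ xs
≈ₗ-sym (f , g) = g , f

SameX-refl : ∀ {t} → SameX t t
SameX-refl = ≈ₗ-refl , (λ h → h) , (λ h → h)

SameX-trans : ∀ {t t' t''} → SameX t t' → SameX t' t'' → SameX t t''
SameX-trans (l , x⊆ , x⊇) (m , y⊆ , y⊇) = ≈ₗ-trans l m , (λ h → y⊆ (x⊆ h)) , (λ h → x⊇ (y⊇ h))

single⇒ : ∀ b c {x y} → XT (node ((b , c) ∷ [])) x y → XT c x y
single⇒ b c (inj₁ (inj₁ h)) = h
single⇒ b c (inj₁ (inj₂ ()))
single⇒ b c (inj₂ (here (_ , x∈ , x∉))) = ⊥-elim (x∉ (proj₁ (≈ₗ-++[] (leavesT c)) x∈))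

single⇐ : ∀ b c {x y} → XT c x y → XT (node ((b , c) ∷ [])) x y
single⇐ b c h = inj₁ (inj₁ h)

fixChild-equiv : ∀ b c → EquivC (b , c) (fixChild b c)
fixChild-equiv b (leaf x) = EquivC-refl
fixChild-equiv b (node []) = EquivC-refl
fixChild-equiv b (node (p ∷ q ∷ cs)) = EquivC-refl
fixChild-equiv b (node ((b' , c) ∷ [])) =
  (ls , proj₁ (os b) , single⇒ b' c) , (≈ₗ-sym ls , proj₂ (os b) , single⇐ b' c)
  where
  ls : (leavesT c ++ []) ≈ₗ leavesT c
  ls = ≈ₗ-++[] (leavesT c)
  os : ∀ b → onesC (b , node ((b' , c) ∷ [])) ≈ₗ onesC (b ∨ b' , c)
  os true = ≈ₗ-++[] (leavesT c)
  os false = ≈ₗ-++[] (onesC (b' , c))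

mutual
  suppress-equiv : ∀ t → Equiv t (suppT t)
  suppress-equiv (leaf x) = Equiv-refl
  suppress-equiv (node cs) = childwise (suppressL-equiv cs)

  suppressL-equiv : ∀ cs → Pointwise EquivC cs (suppL cs)
  suppressL-equiv [] = []
  suppressL-equiv ((b , c) ∷ cs) =
    EquivC-trans (Equiv⇒EquivC b (suppress-equiv c)) (fixChild-equiv b (suppT c)) ∷ suppressL-equiv cs

fixRoot-sameX : ∀ t → SameX t (fixRoot t)
fixRoot-sameX (leaf x) = SameX-refl
fixRoot-sameX (node []) = SameX-refl
fixRoot-sameX (node (p ∷ q ∷ cs)) = SameX-refl
fixRoot-sameX (node ((b , c) ∷ [])) = ≈ₗ-++[] (leavesT c) , single⇒ b c , single⇐ b c

-- Suppression keeps the leaves as a list (so distinctness is kept).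
fixChild-leaves : ∀ b c → leavesC (fixChild b c) ≡ leavesT c
fixChild-leaves b (leaf x) = refl
fixChild-leaves b (node []) = refl
fixChild-leaves b (node (p ∷ q ∷ cs)) = refl
fixChild-leaves b (node ((b' , c) ∷ [])) = sym (++-identityʳ (leavesT c))

mutual
  suppress-leaves : ∀ t → leavesT (suppT t) ≡ leavesT t
  suppress-leaves (leaf x) = refl
  suppress-leaves (node cs) = suppressL-leaves cs

  suppressL-leaves : ∀ cs → leavesL (suppL cs) ≡ leavesL cs
  suppressL-leaves [] = refl
  suppressL-leaves ((b , c) ∷ cs) =
    cong₂ _++_ (trans (fixChild-leaves b (suppT c)) (suppress-leaves c)) (suppressL-leaves cs)

fixRoot-leaves : ∀ t → leavesT (fixRoot t) ≡ leavesT t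
fixRoot-leaves (leaf x) = refl
fixRoot-leaves (node []) = refl
fixRoot-leaves (node (p ∷ q ∷ cs)) = refl
fixRoot-leaves (node ((b , c) ∷ [])) = sym (++-identityʳ (leavesT c))

-- Every inner vertex has a child.  T - v has this property, and suppressing
-- its degree-2 vertices and a degree-1 root then gives a phylogenetic tree.
mutual
  Nonempty : Tree → Set
  Nonempty (leaf _) = ⊤
  Nonempty (node cs) = (1 ≤ length cs) × NonemptyL cs

  NonemptyL : Children → Set
  NonemptyL [] = ⊤
  NonemptyL ((b , c) ∷ cs) = Nonempty c × NonemptyL cs

mutual
  suppressed-phy : ∀ b c → Nonempty c → PhyT (proj₂ (fixChild b (suppT c)))
  suppressed-phy b (leaf x) _ = tt
  suppressed-phy b (node ((b' , c) ∷ [])) (_ , nc , _) = suppressed-phy b' c nc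
  suppressed-phy b (node (p ∷ q ∷ cs)) (_ , ne) = s≤s (s≤s z≤n) , suppressedL-phy (p ∷ q ∷ cs) ne

  suppressedL-phy : ∀ cs → NonemptyL cs → PhyL (suppL cs)
  suppressedL-phy [] _ = tt
  suppressedL-phy ((b , c) ∷ cs) (nc , ne) = suppressed-phy b c nc , suppressedL-phy cs ne

suppressed-root-phy : ∀ cs → Nonempty (node cs) → PhyT (fixRoot (suppT (node cs)))
suppressed-root-phy ((b , c) ∷ []) (_ , nc , _) = suppressed-phy b c nc
suppressed-root-phy (p ∷ q ∷ cs) (_ , ne) = s≤s (s≤s z≤n) , suppressedL-phy (p ∷ q ∷ cs) ne

-- All inner edges are 1-edges.  This holds in reduced trees, survives the
-- deletion of a leaf and suppression, and makes the final contraction reduce.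
mutual
  InnerOnes : Tree → Set
  InnerOnes (leaf _) = ⊤
  InnerOnes (node cs) = InnerOnesL cs

  InnerOnesL : Children → Set
  InnerOnesL [] = ⊤
  InnerOnesL ((b , c) ∷ cs) = (IsInner c → b ≡ true) × InnerOnes c × InnerOnesL cs

reducedL⇒innerOnesL : ∀ cs → ReducedL cs → InnerOnesL cs
reducedL⇒innerOnesL [] _ = tt
reducedL⇒innerOnesL ((b , leaf x) ∷ cs) (_ , _ , r) = (λ ()) , tt , reducedL⇒innerOnesL cs r
reducedL⇒innerOnesL ((b , node ds) ∷ cs) ((e , _) , rd , r) =
  (λ _ → e) , reducedL⇒innerOnesL ds rd , reducedL⇒innerOnesL cs r

mutual
  suppressed-innerOnes : ∀ b c → InnerOnes c → (IsInner c → b ≡ true) →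
                         (IsInner (proj₂ (fixChild b (suppT c))) → proj₁ (fixChild b (suppT c)) ≡ true) ×
                         InnerOnes (proj₂ (fixChild b (suppT c)))
  suppressed-innerOnes b (leaf x) _ e = e , tt
  suppressed-innerOnes b (node []) _ e = e , tt
  suppressed-innerOnes b (node ((b' , c) ∷ [])) (e' , ic , _) e with e tt
  ... | refl = (λ _ → refl) , proj₂ (suppressed-innerOnes b' c ic e')
  suppressed-innerOnes b (node (p ∷ q ∷ cs)) i e = e , suppressedL-innerOnes (p ∷ q ∷ cs) i

  suppressedL-innerOnes : ∀ cs → InnerOnesL cs → InnerOnesL (suppL cs)
  suppressedL-innerOnes [] _ = tt
  suppressedL-innerOnes ((b , c) ∷ cs) (e , ic , i) =
    proj₁ (suppressed-innerOnes b c ic e) , proj₂ (suppressed-innerOnes b c ic e) , suppressedL-innerOnes cs i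

suppressed-root-innerOnes : ∀ cs → InnerOnesL cs → InnerOnes (fixRoot (suppT (node cs)))
suppressed-root-innerOnes [] _ = tt
suppressed-root-innerOnes ((b , c) ∷ []) (e , ic , _) = proj₂ (suppressed-innerOnes b c ic e)
suppressed-root-innerOnes (p ∷ q ∷ cs) i = suppressedL-innerOnes (p ∷ q ∷ cs) i

attach : List ℕ → Bool → Children → Children → Children
attach [] b ds rest = map (orLabel b) ds ++ rest
attach (_ ∷ _) b ds rest = (b , node ds) ∷ rest

mutual
  contractT : Tree → Tree
  contractT (leaf x) = leaf x
  contractT (node cs) = node (contractL cs)

  contractL : Children → Children
  contractL [] = []
  contractL ((b , leaf x) ∷ cs) = (b , leaf x) ∷ contractL cs
  contractL ((b , node ds) ∷ cs) = attach (zerosL (contractL ds)) b (contractL ds) (contractL cs)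

-- contractL is computed child by child; the processed children form a prefix.
reassoc : ∀ (R : Tree → Tree → Set) pre xs cs cs' →
          R (node ((pre ++ xs) ++ cs)) (node ((pre ++ xs) ++ cs')) → R (node (pre ++ xs ++ cs)) (node (pre ++ xs ++ cs'))
reassoc R pre xs cs cs' = subst₂ (λ a c → R (node a) (node c)) (++-assoc pre xs cs) (++-assoc pre xs cs')

liftSteps : ∀ pre b post {c c'} → Star DContr c c' →
            Star DContr (node (pre ++ (b , c) ∷ post)) (node (pre ++ (b , c') ∷ post))
liftSteps pre b post ε = ε
liftSteps pre b post (s ◅ ss) = deep pre b post s ◅ liftSteps pre b post ss

contractL-steps : ∀ pre cs → Star DContr (node (pre ++ cs)) (node (pre ++ contractL cs))
contractL-steps pre [] = ε
contractL-steps pre ((b , leaf x) ∷ cs) =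
  reassoc (Star DContr) pre [ (b , leaf x) ] cs (contractL cs) (contractL-steps (pre ++ [ (b , leaf x) ]) cs)
contractL-steps pre ((b , node ds) ∷ cs) = liftSteps pre b cs (contractL-steps [] ds) ◅◅ attach-steps (contractL ds)
  where
  attach-steps : ∀ ds' → Star DContr (node (pre ++ (b , node ds') ∷ cs))
                                     (node (pre ++ attach (zerosL ds') b ds' (contractL cs)))
  attach-steps ds' with zerosL ds'
  ... | [] = here pre b ds' cs ◅
             reassoc (Star DContr) pre (map (orLabel b) ds') cs (contractL cs)
               (contractL-steps (pre ++ map (orLabel b) ds') cs)
  ... | _ ∷ _ = reassoc (Star DContr) pre [ (b , node ds') ] cs (contractL cs)
                  (contractL-steps (pre ++ [ (b , node ds') ]) cs)

contractT-steps : ∀ t → Star DContr t (contractT t)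
contractT-steps (leaf x) = ε
contractT-steps (node cs) = contractL-steps [] cs

-- When all inner edges are 1-edges, the contraction preserves the relation:
-- each contracted edge is contractible, and relabelling the moved edges by 1 is
-- harmless because the lower end had no zero leaf.
relabel : ∀ ds → (∀ {z} → z ∉ zerosL ds) → Pointwise EquivC ds (map (orLabel true) ds)
relabel [] nz = []
relabel ((true , c) ∷ ds) nz = EquivC-refl ∷ relabel ds nz
relabel ((false , c) ∷ ds) nz =
  ((≈ₗ-refl , ones⊆leaves c , λ h → h) , (≈ₗ-refl , leaves⊆ones , λ h → h)) ∷ relabel ds (λ i → nz (∈-++⁺ʳ (zerosT c) i))
  where
  leaves⊆ones : leavesT c ⊆ onesT c
  leaves⊆ones i with ones-zeros-cover c i
  ... | inj₁ o = o
  ... | inj₂ z = ⊥-elim (nz (∈-++⁺ˡ z))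

contractL-equiv : ∀ pre cs → InnerOnesL cs → Equiv (node (pre ++ cs)) (node (pre ++ contractL cs))
contractL-equiv pre [] _ = Equiv-refl
contractL-equiv pre ((b , leaf x) ∷ cs) (_ , _ , i) =
  reassoc Equiv pre [ (b , leaf x) ] cs (contractL cs) (contractL-equiv (pre ++ [ (b , leaf x) ]) cs i)
contractL-equiv pre ((b , node ds) ∷ cs) (e , ids , i) with e tt
... | refl = Equiv-trans (replaceChild pre cs (Equiv⇒EquivC true (contractL-equiv [] ds ids)))
                         (attach-equiv (contractL ds))
  where
  attach-equiv : ∀ ds' → Equiv (node (pre ++ (true , node ds') ∷ cs))
                               (node (pre ++ attach (zerosL ds') true ds' (contractL cs)))
  attach-equiv ds' with zerosL ds' in zs
  ... | [] = Equiv-trans (Equiv-trans (contractEdge pre true ds' cs (inj₂ nz)) (replaceBlock pre cs (relabel ds' nz)))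
                         (reassoc Equiv pre (map (orLabel true) ds') cs (contractL cs)
                            (contractL-equiv (pre ++ map (orLabel true) ds') cs i))
    where
    nz : ∀ {z} → z ∉ zerosL ds'
    nz i = ¬Any[] (subst (_ ∈_) zs i)
  ... | _ ∷ _ = reassoc Equiv pre [ (true , node ds') ] cs (contractL cs)
                  (contractL-equiv (pre ++ [ (true , node ds') ]) cs i)

contractT-equiv : ∀ t → InnerOnes t → Equiv t (contractT t)
contractT-equiv (leaf x) _ = Equiv-refl
contractT-equiv (node cs) i = contractL-equiv [] cs i

leavesL-map : ∀ b ds → leavesL (map (orLabel b) ds) ≡ leavesL ds
leavesL-map b [] = refl
leavesL-map b ((b' , c) ∷ ds) = cong (leavesT c ++_) (leavesL-map b ds)

mutual
  contractL-leaves : ∀ cs → leavesL (contractL cs) ≡ leavesL cs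
  contractL-leaves [] = refl
  contractL-leaves ((b , leaf x) ∷ cs) = cong (x ∷_) (contractL-leaves cs)
  contractL-leaves ((b , node ds) ∷ cs) = attach-leaves (zerosL (contractL ds)) (contractL-leaves ds)
    where
    attach-leaves : ∀ zs → leavesL (contractL ds) ≡ leavesL ds →
                    leavesL (attach zs b (contractL ds) (contractL cs)) ≡ leavesL ds ++ leavesL cs
    attach-leaves [] e = trans (leavesL-++ (map (orLabel b) (contractL ds)) (contractL cs))
                               (cong₂ _++_ (trans (leavesL-map b (contractL ds)) e) (contractL-leaves cs))
    attach-leaves (_ ∷ _) e = cong₂ _++_ e (contractL-leaves cs)

contractT-leaves : ∀ t → leavesT (contractT t) ≡ leavesT t
contractT-leaves (leaf x) = refl
contractT-leaves (node cs) = contractL-leaves cs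

-- The contraction keeps a tree phylogenetic: no vertex loses children.
PhyL-++ : ∀ xs ys → PhyL xs → PhyL ys → PhyL (xs ++ ys)
PhyL-++ [] ys _ q = q
PhyL-++ ((b , c) ∷ xs) ys (p , ps) q = p , PhyL-++ xs ys ps q

PhyL-map : ∀ b xs → PhyL xs → PhyL (map (orLabel b) xs)
PhyL-map b [] _ = tt
PhyL-map b ((b' , c) ∷ xs) (p , ps) = p , PhyL-map b xs ps

mutual
  contractT-phy : ∀ t → PhyT t → PhyT (contractT t)
  contractT-phy (leaf x) _ = tt
  contractT-phy (node cs) (l , ph) = ≤-trans l (proj₂ (contractL-phy cs ph)) , proj₁ (contractL-phy cs ph)

  contractL-phy : ∀ cs → PhyL cs → PhyL (contractL cs) × (length cs ≤ length (contractL cs))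
  contractL-phy [] _ = tt , z≤n
  contractL-phy ((b , leaf x) ∷ cs) (_ , ph) = (tt , proj₁ (contractL-phy cs ph)) , s≤s (proj₂ (contractL-phy cs ph))
  contractL-phy ((b , node ds) ∷ cs) (phd , ph) = attach-phy (zerosL (contractL ds)) (contractT-phy (node ds) phd)
    where
    rest : PhyL (contractL cs) × (length cs ≤ length (contractL cs))
    rest = contractL-phy cs ph
    attach-phy : ∀ zs → PhyT (node (contractL ds)) →
                 PhyL (attach zs b (contractL ds) (contractL cs)) ×
                 (suc (length cs) ≤ length (attach zs b (contractL ds) (contractL cs)))
    attach-phy [] (l , pd) =
      PhyL-++ (map (orLabel b) (contractL ds)) (contractL cs) (PhyL-map b (contractL ds) pd) (proj₁ rest) ,
      (begin
        suc (length cs)                                            ≤⟨ s≤s (proj₂ rest) ⟩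
        1 + length (contractL cs)                                  ≤⟨ +-monoˡ-≤ (length (contractL cs)) (≤-trans (s≤s z≤n) l) ⟩
        length (contractL ds) + length (contractL cs)              ≡⟨ cong (_+ length (contractL cs)) (sym (length-map (orLabel b) (contractL ds))) ⟩
        length (map (orLabel b) (contractL ds)) + length (contractL cs) ≡⟨ sym (length-++ (map (orLabel b) (contractL ds))) ⟩
        length (map (orLabel b) (contractL ds) ++ contractL cs)    ∎)
      where open ≤-Reasoning
    attach-phy (_ ∷ _) phd' = (phd' , proj₁ rest) , s≤s (proj₂ rest)

ReducedL-++ : ∀ xs ys → ReducedL xs → ReducedL ys → ReducedL (xs ++ ys)
ReducedL-++ [] ys _ r = r
ReducedL-++ ((b , c) ∷ xs) ys (e , r , rs) r' = e , r , ReducedL-++ xs ys rs r'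

ReducedL-relabel : ∀ xs → ReducedL xs → ReducedL (map (orLabel true) xs)
ReducedL-relabel [] _ = tt
ReducedL-relabel ((b , leaf x) ∷ xs) (_ , r , rs) = tt , r , ReducedL-relabel xs rs
ReducedL-relabel ((b , node ds) ∷ xs) ((_ , z) , r , rs) = (refl , z) , r , ReducedL-relabel xs rs

mutual
  contractT-reduced : ∀ t → InnerOnes t → Reduced (contractT t)
  contractT-reduced (leaf x) _ = tt
  contractT-reduced (node cs) i = contractL-reduced cs i

  contractL-reduced : ∀ cs → InnerOnesL cs → ReducedL (contractL cs)
  contractL-reduced [] _ = tt
  contractL-reduced ((b , leaf x) ∷ cs) (_ , _ , i) = tt , tt , contractL-reduced cs i
  contractL-reduced ((b , node ds) ∷ cs) (e , ids , i) with e tt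
  ... | refl = attach-reduced (contractL ds) (contractL-reduced ds ids)
    where
    attach-reduced : ∀ ds' → ReducedL ds' → ReducedL (attach (zerosL ds') true ds' (contractL cs))
    attach-reduced ds' r with zerosL ds' in zs
    ... | [] = ReducedL-++ (map (orLabel true) ds') (contractL cs) (ReducedL-relabel ds' r) (contractL-reduced cs i)
    ... | z ∷ _ = (refl , z , subst (z ∈_) (sym zs) (here refl)) , r , contractL-reduced cs i

inner≢leaf : ∀ {t x} → IsInner t → t ≢ leaf x
inner≢leaf {leaf _} ()
inner≢leaf {node _} _ ()

vertexInner : ∀ {t r cs'} → Vertex t r cs' → IsInner t
vertexInner root = tt
vertexInner (below _ _) = tt

vertexLeaves : ∀ {t r cs'} → Vertex t r cs' → leavesL cs' ⊆ leavesT t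
vertexLeaves root i = i
vertexLeaves {node cs} (below j V) i = leavesL⁺ cs j (vertexLeaves V i)

innerEdge : ∀ {b t} → ReducedEdge b t → IsInner t → b ≡ true
innerEdge {t = node _} (e , _) _ = e

false≢true : false ≢ true
false≢true ()

module _ (v : ℕ) where

  deleteC : Bool × Tree → Bool × Tree
  deleteC p = proj₁ p , deleteT v (proj₂ p)

  deleteL⁺ : ∀ cs {p} → p ∈ cs → proj₂ p ≢ leaf v → deleteC p ∈ deleteL v cs
  deleteL⁺ ((b , leaf x) ∷ cs) (here refl) ne with x ≡ᵇ v | proof (x ≟ v)
  ... | true | ofʸ refl = ⊥-elim (ne refl)
  ... | false | ofⁿ _ = here refl
  deleteL⁺ ((b , node ds) ∷ cs) (here refl) ne = here refl
  deleteL⁺ ((b , leaf x) ∷ cs) (there i) ne with x ≡ᵇ v | proof (x ≟ v)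
  ... | true | ofʸ _ = deleteL⁺ cs i ne
  ... | false | ofⁿ _ = there (deleteL⁺ cs i ne)
  deleteL⁺ ((b , node ds) ∷ cs) (there i) ne = there (deleteL⁺ cs i ne)

  deleteL⁻ : ∀ cs {p'} → p' ∈ deleteL v cs →
             Σ (Bool × Tree) (λ p → p ∈ cs × (proj₂ p ≢ leaf v) × (p' ≡ deleteC p))
  deleteL⁻ ((b , leaf x) ∷ cs) i with x ≡ᵇ v | proof (x ≟ v)
  ... | true | ofʸ _ with deleteL⁻ cs i
  ...   | p , j , ne , e = p , there j , ne , e
  deleteL⁻ ((b , leaf x) ∷ cs) (here refl) | false | ofⁿ x≢v = (b , leaf x) , here refl , (λ { refl → x≢v refl }) , refl
  deleteL⁻ ((b , leaf x) ∷ cs) (there i) | false | ofⁿ _ with deleteL⁻ cs i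
  ... | p , j , ne , e = p , there j , ne , e
  deleteL⁻ ((b , node ds) ∷ cs) (here refl) = (b , node ds) , here refl , (λ ()) , refl
  deleteL⁻ ((b , node ds) ∷ cs) (there i) with deleteL⁻ cs i
  ... | p , j , ne , e = p , there j , ne , e

  deleteL-leaves⁻ : ∀ cs {x} → x ∈ leavesL (deleteL v cs) → (x ∈ leavesL cs) × (x ≢ v)
  deleteL-leaves⁻ ((b , leaf y) ∷ cs) i with y ≡ᵇ v | proof (y ≟ v)
  ... | true | ofʸ _ = map₁ there (deleteL-leaves⁻ cs i)
  deleteL-leaves⁻ ((b , leaf y) ∷ cs) (here refl) | false | ofⁿ y≢v = here refl , y≢v
  deleteL-leaves⁻ ((b , leaf y) ∷ cs) (there i) | false | ofⁿ _ = map₁ there (deleteL-leaves⁻ cs i)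
  deleteL-leaves⁻ ((b , node ds) ∷ cs) i with ∈-++⁻ (leavesL (deleteL v ds)) i
  ... | inj₁ j = map₁ ∈-++⁺ˡ (deleteL-leaves⁻ ds j)
  ... | inj₂ j = map₁ (∈-++⁺ʳ (leavesL ds)) (deleteL-leaves⁻ cs j)

  deleteL-leaves⁺ : ∀ cs {x} → x ∈ leavesL cs → x ≢ v → x ∈ leavesL (deleteL v cs)
  deleteL-leaves⁺ ((b , leaf y) ∷ cs) i x≢v with y ≡ᵇ v | proof (y ≟ v)
  deleteL-leaves⁺ ((b , leaf y) ∷ cs) (here refl) x≢v | true | ofʸ refl = ⊥-elim (x≢v refl)
  deleteL-leaves⁺ ((b , leaf y) ∷ cs) (there i) x≢v | true | ofʸ _ = deleteL-leaves⁺ cs i x≢v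
  deleteL-leaves⁺ ((b , leaf y) ∷ cs) (here refl) x≢v | false | ofⁿ _ = here refl
  deleteL-leaves⁺ ((b , leaf y) ∷ cs) (there i) x≢v | false | ofⁿ _ = there (deleteL-leaves⁺ cs i x≢v)
  deleteL-leaves⁺ ((b , node ds) ∷ cs) i x≢v with ∈-++⁻ (leavesL ds) i
  ... | inj₁ j = ∈-++⁺ˡ (deleteL-leaves⁺ ds j x≢v)
  ... | inj₂ j = ∈-++⁺ʳ (leavesL (deleteL v ds)) (deleteL-leaves⁺ cs j x≢v)

  deleteL-ones⁻ : ∀ cs {x} → x ∈ onesL (deleteL v cs) → (x ∈ onesL cs) × (x ≢ v)
  deleteL-ones⁻ ((b , leaf y) ∷ cs) i with y ≡ᵇ v | proof (y ≟ v)
  ... | true | ofʸ _ = map₁ (∈-++⁺ʳ (onesC (b , leaf y))) (deleteL-ones⁻ cs i)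
  deleteL-ones⁻ ((true , leaf y) ∷ cs) (here refl) | false | ofⁿ y≢v = here refl , y≢v
  deleteL-ones⁻ ((true , leaf y) ∷ cs) (there i) | false | ofⁿ _ = map₁ there (deleteL-ones⁻ cs i)
  deleteL-ones⁻ ((false , leaf y) ∷ cs) i | false | ofⁿ _ = deleteL-ones⁻ cs i
  deleteL-ones⁻ ((true , node ds) ∷ cs) i with ∈-++⁻ (leavesL (deleteL v ds)) i
  ... | inj₁ j = map₁ ∈-++⁺ˡ (deleteL-leaves⁻ ds j)
  ... | inj₂ j = map₁ (∈-++⁺ʳ (leavesL ds)) (deleteL-ones⁻ cs j)
  deleteL-ones⁻ ((false , node ds) ∷ cs) i with ∈-++⁻ (onesL (deleteL v ds)) i
  ... | inj₁ j = map₁ ∈-++⁺ˡ (deleteL-ones⁻ ds j)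
  ... | inj₂ j = map₁ (∈-++⁺ʳ (onesL ds)) (deleteL-ones⁻ cs j)

  deleteL-ones⁺ : ∀ cs {x} → x ∈ onesL cs → x ≢ v → x ∈ onesL (deleteL v cs)
  deleteL-ones⁺ ((b , leaf y) ∷ cs) i x≢v with y ≡ᵇ v | proof (y ≟ v)
  deleteL-ones⁺ ((true , leaf y) ∷ cs) (here refl) x≢v | true | ofʸ refl = ⊥-elim (x≢v refl)
  deleteL-ones⁺ ((true , leaf y) ∷ cs) (there i) x≢v | true | ofʸ _ = deleteL-ones⁺ cs i x≢v
  deleteL-ones⁺ ((false , leaf y) ∷ cs) i x≢v | true | ofʸ _ = deleteL-ones⁺ cs i x≢v
  deleteL-ones⁺ ((true , leaf y) ∷ cs) (here refl) x≢v | false | ofⁿ _ = here refl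
  deleteL-ones⁺ ((true , leaf y) ∷ cs) (there i) x≢v | false | ofⁿ _ = there (deleteL-ones⁺ cs i x≢v)
  deleteL-ones⁺ ((false , leaf y) ∷ cs) i x≢v | false | ofⁿ _ = deleteL-ones⁺ cs i x≢v
  deleteL-ones⁺ ((true , node ds) ∷ cs) i x≢v with ∈-++⁻ (leavesL ds) i
  ... | inj₁ j = ∈-++⁺ˡ (deleteL-leaves⁺ ds j x≢v)
  ... | inj₂ j = ∈-++⁺ʳ (leavesL (deleteL v ds)) (deleteL-ones⁺ cs j x≢v)
  deleteL-ones⁺ ((false , node ds) ∷ cs) i x≢v with ∈-++⁻ (onesL ds) i
  ... | inj₁ j = ∈-++⁺ˡ (deleteL-ones⁺ ds j x≢v)
  ... | inj₂ j = ∈-++⁺ʳ (onesL (deleteL v ds)) (deleteL-ones⁺ cs j x≢v)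

  deleteC-leaves⁻ : ∀ p → proj₂ p ≢ leaf v → ∀ {x} → x ∈ leavesC (deleteC p) → (x ∈ leavesC p) × (x ≢ v)
  deleteC-leaves⁻ (b , leaf y) ne (here refl) = here refl , λ { refl → ne refl }
  deleteC-leaves⁻ (b , node ds) ne i = deleteL-leaves⁻ ds i

  deleteC-leaves⁺ : ∀ p {x} → x ∈ leavesC p → x ≢ v → x ∈ leavesC (deleteC p)
  deleteC-leaves⁺ (b , leaf y) i _ = i
  deleteC-leaves⁺ (b , node ds) i x≢v = deleteL-leaves⁺ ds i x≢v

  deleteC-ones⁻ : ∀ p → proj₂ p ≢ leaf v → ∀ {x} → x ∈ onesC (deleteC p) → (x ∈ onesC p) × (x ≢ v)
  deleteC-ones⁻ (true , c) ne i = deleteC-leaves⁻ (true , c) ne i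
  deleteC-ones⁻ (false , node ds) ne i = deleteL-ones⁻ ds i

  deleteC-ones⁺ : ∀ p {x} → x ∈ onesC p → x ≢ v → x ∈ onesC (deleteC p)
  deleteC-ones⁺ (true , c) i x≢v = deleteC-leaves⁺ (true , c) i x≢v
  deleteC-ones⁺ (false , node ds) i x≢v = deleteL-ones⁺ ds i x≢v

  mutual
    deleteX⁻ : ∀ cs {x y} → XT (node (deleteL v cs)) x y → XT (node cs) x y × (x ≢ v) × (y ≢ v)
    deleteX⁻ cs (inj₁ h) with deleteXL⁻ cs h
    ... | h' , x≢v , y≢v = inj₁ h' , x≢v , y≢v
    deleteX⁻ cs (inj₂ h) with find h
    ... | p' , i , (y∈ , x∈ , x∉) with deleteL⁻ cs i
    ... | p , j , ne , refl with deleteC-ones⁻ p ne y∈ | deleteL-leaves⁻ cs x∈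
    ... | y∈' , y≢v | x∈' , x≢v = XT-at cs j x∈' (λ xp → x∉ (deleteC-leaves⁺ p xp x≢v)) y∈' , x≢v , y≢v

    deleteXL⁻ : ∀ cs {x y} → XL (deleteL v cs) x y → XL cs x y × (x ≢ v) × (y ≢ v)
    deleteXL⁻ ((b , leaf y₀) ∷ cs) h with y₀ ≡ᵇ v | proof (y₀ ≟ v)
    ... | true | ofʸ _ = map₁ inj₂ (deleteXL⁻ cs h)
    deleteXL⁻ ((b , leaf y₀) ∷ cs) (inj₂ h) | false | ofⁿ _ = map₁ inj₂ (deleteXL⁻ cs h)
    deleteXL⁻ ((b , node ds) ∷ cs) (inj₁ h) = map₁ inj₁ (deleteX⁻ ds h)
    deleteXL⁻ ((b , node ds) ∷ cs) (inj₂ h) = map₁ inj₂ (deleteXL⁻ cs h)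

  mutual
    deleteX⁺ : ∀ cs {x y} → XT (node cs) x y → x ≢ v → y ≢ v → XT (node (deleteL v cs)) x y
    deleteX⁺ cs (inj₁ h) x≢v y≢v = inj₁ (deleteXL⁺ cs h x≢v y≢v)
    deleteX⁺ cs (inj₂ h) x≢v y≢v with find h
    ... | p , j , (y∈ , x∈ , x∉) =
      XT-at (deleteL v cs) (deleteL⁺ cs j (notLeafV p y∈ y≢v)) (deleteL-leaves⁺ cs x∈ x≢v)
            (λ xp → x∉ (proj₁ (deleteC-leaves⁻ p (notLeafV p y∈ y≢v) xp))) (deleteC-ones⁺ p y∈ y≢v)
      where
      notLeafV : ∀ p {y} → y ∈ onesC p → y ≢ v → proj₂ p ≢ leaf v
      notLeafV (true , leaf x) (here refl) y≢v refl = y≢v refl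
      notLeafV (b , node _) _ _ ()

    deleteXL⁺ : ∀ cs {x y} → XL cs x y → x ≢ v → y ≢ v → XL (deleteL v cs) x y
    deleteXL⁺ ((b , leaf y₀) ∷ cs) (inj₂ h) x≢v y≢v with y₀ ≡ᵇ v | proof (y₀ ≟ v)
    ... | true | ofʸ _ = deleteXL⁺ cs h x≢v y≢v
    ... | false | ofⁿ _ = inj₂ (deleteXL⁺ cs h x≢v y≢v)
    deleteXL⁺ ((b , node ds) ∷ cs) (inj₁ h) x≢v y≢v = inj₁ (deleteX⁺ ds h x≢v y≢v)
    deleteXL⁺ ((b , node ds) ∷ cs) (inj₂ h) x≢v y≢v = inj₂ (deleteXL⁺ cs h x≢v y≢v)

  deletion-explains : ∀ cs → Explains (λ x → (x ∈ leavesL cs) × (x ≢ v))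
                                      (λ x y → XT (node cs) x y × (x ≢ v) × (y ≢ v)) (node (deleteL v cs))
  deletion-explains cs =
    (λ x → mk⇔ (λ { (x∈ , x≢v) → deleteL-leaves⁺ cs x∈ x≢v }) (deleteL-leaves⁻ cs)) ,
    (λ x y → mk⇔ (λ { (h , x≢v , y≢v) → deleteX⁺ cs h x≢v y≢v }) (deleteX⁻ cs))

  deleteL-zeros⁺ : ∀ cs {z} → z ∈ zerosL cs → z ≢ v → z ∈ zerosL (deleteL v cs)
  deleteL-zeros⁺ ((b , leaf y) ∷ cs) i z≢v with y ≡ᵇ v | proof (y ≟ v)
  deleteL-zeros⁺ ((true , leaf y) ∷ cs) i z≢v | true | ofʸ _ = deleteL-zeros⁺ cs i z≢v
  deleteL-zeros⁺ ((false , leaf y) ∷ cs) (here refl) z≢v | true | ofʸ refl = ⊥-elim (z≢v refl)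
  deleteL-zeros⁺ ((false , leaf y) ∷ cs) (there i) z≢v | true | ofʸ _ = deleteL-zeros⁺ cs i z≢v
  deleteL-zeros⁺ ((true , leaf y) ∷ cs) i z≢v | false | ofⁿ _ = deleteL-zeros⁺ cs i z≢v
  deleteL-zeros⁺ ((false , leaf y) ∷ cs) (here refl) z≢v | false | ofⁿ _ = here refl
  deleteL-zeros⁺ ((false , leaf y) ∷ cs) (there i) z≢v | false | ofⁿ _ = there (deleteL-zeros⁺ cs i z≢v)
  deleteL-zeros⁺ ((true , node ds) ∷ cs) i z≢v = deleteL-zeros⁺ cs i z≢v
  deleteL-zeros⁺ ((false , node ds) ∷ cs) i z≢v with ∈-++⁻ (zerosL ds) i
  ... | inj₁ j = ∈-++⁺ˡ (deleteL-zeros⁺ ds j z≢v)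
  ... | inj₂ j = ∈-++⁺ʳ (zerosL (deleteL v ds)) (deleteL-zeros⁺ cs j z≢v)

  deleteL-absent : ∀ cs → v ∉ leavesL cs → deleteL v cs ≡ cs
  deleteL-absent [] _ = refl
  deleteL-absent ((b , leaf y) ∷ cs) v∉ with y ≡ᵇ v | proof (y ≟ v)
  ... | true | ofʸ refl = ⊥-elim (v∉ (here refl))
  ... | false | ofⁿ _ = cong ((b , leaf y) ∷_) (deleteL-absent cs (λ i → v∉ (there i)))
  deleteL-absent ((b , node ds) ∷ cs) v∉ =
    cong₂ (λ ds' cs' → (b , node ds') ∷ cs')
          (deleteL-absent ds (λ i → v∉ (∈-++⁺ˡ i))) (deleteL-absent cs (λ i → v∉ (∈-++⁺ʳ (leavesL ds) i)))

  deleteT-absent : ∀ c → v ∉ leavesT c → deleteT v c ≡ c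
  deleteT-absent (leaf y) _ = refl
  deleteT-absent (node ds) v∉ = cong node (deleteL-absent ds v∉)

  deleteL-unique : ∀ cs → Unique (leavesL cs) → Unique (leavesL (deleteL v cs))
  deleteL-unique [] u = u
  deleteL-unique ((b , leaf y) ∷ cs) (y∉ ∷ u) with y ≡ᵇ v | proof (y ≟ v)
  ... | true | ofʸ _ = deleteL-unique cs u
  ... | false | ofⁿ _ = tabulate (λ i → lookup y∉ (proj₁ (deleteL-leaves⁻ cs i))) ∷ deleteL-unique cs u
  deleteL-unique ((b , node ds) ∷ cs) u with Unique-++⁻ {leavesL ds} u
  ... | u₁ , u₂ , disj = Unique-++⁺ (deleteL-unique ds u₁) (deleteL-unique cs u₂)
                           (λ i j → disj (proj₁ (deleteL-leaves⁻ ds i)) (proj₁ (deleteL-leaves⁻ cs j)))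

  deleteL-length≤ : ∀ cs → length (deleteL v cs) ≤ length cs
  deleteL-length≤ [] = z≤n
  deleteL-length≤ ((b , leaf y) ∷ cs) with y ≡ᵇ v | proof (y ≟ v)
  ... | true | ofʸ _ = m≤n⇒m≤1+n (deleteL-length≤ cs)
  ... | false | ofⁿ _ = s≤s (deleteL-length≤ cs)
  deleteL-length≤ ((b , node ds) ∷ cs) = s≤s (deleteL-length≤ cs)

  deleteL-length< : ∀ cs → HasLeafChild v cs → suc (length (deleteL v cs)) ≤ length cs
  deleteL-length< ((b , leaf y) ∷ cs) h with y ≡ᵇ v | proof (y ≟ v)
  deleteL-length< ((b , leaf y) ∷ cs) h | true | ofʸ _ = s≤s (deleteL-length≤ cs)
  deleteL-length< ((b , leaf y) ∷ cs) (here refl) | false | ofⁿ y≢v = ⊥-elim (y≢v refl)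
  deleteL-length< ((b , leaf y) ∷ cs) (there h) | false | ofⁿ _ = s≤s (deleteL-length< cs h)
  deleteL-length< ((b , node ds) ∷ cs) (there h) = s≤s (deleteL-length< cs h)

  deleteL-length≥ : ∀ cs → Unique (leavesL cs) → length cs ≤ suc (length (deleteL v cs))
  deleteL-length≥ [] u = z≤n
  deleteL-length≥ ((b , leaf y) ∷ cs) (y∉ ∷ u) with y ≡ᵇ v | proof (y ≟ v)
  ... | true | ofʸ refl = s≤s (≤-reflexive (cong length (sym (deleteL-absent cs (λ i → lookup y∉ i refl)))))
  ... | false | ofⁿ _ = s≤s (deleteL-length≥ cs u)
  deleteL-length≥ ((b , node ds) ∷ cs) u = s≤s (deleteL-length≥ cs (proj₁ (proj₂ (Unique-++⁻ {leavesL ds} u))))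

  deleteL-length-absent : ∀ cs → (∀ {b} → (b , leaf v) ∉ cs) → length (deleteL v cs) ≡ length cs
  deleteL-length-absent [] _ = refl
  deleteL-length-absent ((b , leaf y) ∷ cs) n with y ≡ᵇ v | proof (y ≟ v)
  ... | true | ofʸ refl = ⊥-elim (n (here refl))
  ... | false | ofⁿ _ = cong suc (deleteL-length-absent cs (λ i → n (there i)))
  deleteL-length-absent ((b , node ds) ∷ cs) n = cong suc (deleteL-length-absent cs (λ i → n (there i)))

  -- In a phylogenetic tree with distinct leaves, no vertex becomes empty, so
  -- T - v (after suppression) is a tree on L - v; inner 1-edges stay inner 1-edges.
  deleteL-length-phy : ∀ cs → 2 ≤ length cs → Unique (leavesL cs) → 1 ≤ length (deleteL v cs)
  deleteL-length-phy cs l u = ≤-pred (≤-trans l (deleteL-length≥ cs u))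

  deleteL-nonempty : ∀ cs → PhyL cs → Unique (leavesL cs) → NonemptyL (deleteL v cs)
  deleteL-nonempty [] _ _ = tt
  deleteL-nonempty ((b , leaf y) ∷ cs) (_ , ph) (_ ∷ u) with y ≡ᵇ v | proof (y ≟ v)
  ... | true | ofʸ _ = deleteL-nonempty cs ph u
  ... | false | ofⁿ _ = tt , deleteL-nonempty cs ph u
  deleteL-nonempty ((b , node ds) ∷ cs) ((l , pd) , ph) u with Unique-++⁻ {leavesL ds} u
  ... | u₁ , u₂ , _ = (deleteL-length-phy ds l u₁ , deleteL-nonempty ds pd u₁) , deleteL-nonempty cs ph u₂

  deleteL-innerOnes : ∀ cs → InnerOnesL cs → InnerOnesL (deleteL v cs)
  deleteL-innerOnes [] _ = tt
  deleteL-innerOnes ((b , leaf y) ∷ cs) (e , _ , i) with y ≡ᵇ v | proof (y ≟ v)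
  ... | true | ofʸ _ = deleteL-innerOnes cs i
  ... | false | ofⁿ _ = e , tt , deleteL-innerOnes cs i
  deleteL-innerOnes ((b , node ds) ∷ cs) (e , ids , i) = e , deleteL-innerOnes ds ids , deleteL-innerOnes cs i

  deleteC-absent : ∀ p → v ∉ leavesC p → deleteC p ≡ p
  deleteC-absent (b , c) v∉ = cong (b ,_) (deleteT-absent c v∉)

  Parent : Tree → Set
  Parent t = Σ Bool (λ r → Σ Children (λ cs' → Vertex t r cs' × HasLeafChild v cs'))

  mutual
    parentOf : ∀ cs → v ∈ leavesL cs → Parent (node cs)
    parentOf cs i = parentAmong cs cs (λ k → k) i

    parentAmong : ∀ cs sub → (∀ {p} → p ∈ sub → p ∈ cs) → v ∈ leavesL sub → Parent (node cs)
    parentAmong cs ((b , leaf x) ∷ sub) inc (here refl) = true , cs , root , lose (inc (here refl)) refl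
    parentAmong cs ((b , leaf x) ∷ sub) inc (there i) = parentAmong cs sub (λ k → inc (there k)) i
    parentAmong cs ((b , node es) ∷ sub) inc i with ∈-++⁻ (leavesL es) i
    ... | inj₁ j with parentOf es j
    ...   | r , cs' , V , h = false , cs' , below (inc (here refl)) V , h
    parentAmong cs ((b , node es) ∷ sub) inc i | inj₂ j = parentAmong cs sub (λ k → inc (there k)) j

  hasLeafChild⇒∈ : ∀ {cs'} → HasLeafChild v cs' → v ∈ leavesL cs'
  hasLeafChild⇒∈ {cs'} h with find h
  ... | p , i , e = leavesL⁺ cs' i (subst (λ t → v ∈ leavesT t) (sym e) (here refl))

  imageAtVertex : ∀ b {c r ds} → Vertex c r ds → PhyT (deleteT v c) → Reduced (deleteT v c) →
                  ReducedEdge b (deleteT v c) → PhyT (node (deleteL v ds)) × Σ ℕ (λ z → z ∈ zerosL (deleteL v ds))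
  imageAtVertex b root ph _ (_ , z∈) = ph , z∈
  imageAtVertex b {node cs} (below {p = p} i V) (_ , ph) r _ =
    imageAtVertex (proj₁ p) V (phyChild (deleteL v cs) ph k) (proj₂ (reducedChild (deleteL v cs) r k))
                  (proj₁ (reducedChild (deleteL v cs) r k))
    where
    k : deleteC p ∈ deleteL v cs
    k = deleteL⁺ cs i (inner≢leaf (vertexInner V))

  zeroEdge : ∀ ds {z} → z ∈ zerosL (deleteL v ds) → Any (λ p → (proj₁ p ≡ false) × (proj₂ p ≢ leaf v)) ds
  zeroEdge ds z∈ with zerosL⁻ (deleteL v ds) z∈
  ... | p' , i , e , _ with deleteL⁻ ds i
  ... | p , j , ne , refl = lose j (e , ne)

  good⇒conditions : ∀ cs → v ∈ leavesL cs → PhyT (node (deleteL v cs)) → ReducedL (deleteL v cs) →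
                    CondI (node cs) v ⊎ CondII (node cs) v
  good⇒conditions cs v∈ ph r with parentOf cs v∈
  ... | _ , _ , root , h = inj₁ (cs , root , h , ≤-trans (s≤s (proj₁ ph)) (deleteL-length< cs h))
  ... | _ , cs' , below {p = p} i V , h = inj₂ (false , cs' , below i V , h , degree , zeroEdge cs' (proj₂ (proj₂ image)))
    where
    k : deleteC p ∈ deleteL v cs
    k = deleteL⁺ cs i (inner≢leaf (vertexInner V))
    image : PhyT (node (deleteL v cs')) × Σ ℕ (λ z → z ∈ zerosL (deleteL v cs'))
    image = imageAtVertex (proj₁ p) V (phyChild (deleteL v cs) (proj₂ ph) k)
              (proj₂ (reducedChild (deleteL v cs) r k)) (proj₁ (reducedChild (deleteL v cs) r k))
    degree : 3 < suc (length cs')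
    degree = s≤s (≤-trans (s≤s (proj₁ (proj₁ image))) (deleteL-length< cs' h))

  keptChild : ∀ cs → Unique (leavesL cs) → HasLeafChild v cs → ∀ {p'} → p' ∈ deleteL v cs → p' ∈ cs
  keptChild cs u h i with deleteL⁻ cs i | find h
  ... | p , k , ne , refl | q , j , e = subst (_∈ cs) (sym (deleteC-absent p v∉p)) k
    where
    v∉p : v ∉ leavesC p
    v∉p vp = ne (trans (cong proj₂ (sharedLeaf cs u k j vp (subst (λ t → v ∈ leavesT t) (sym e) (here refl)))) e)

  deleteAtParent : ∀ cs → Proper (node cs) → HasLeafChild v cs → 2 < length cs →
                   PhyT (node (deleteL v cs)) × ReducedL (deleteL v cs)
  deleteAtParent cs ((_ , ph) , r , u) h d =
    (≤-pred (≤-trans d (deleteL-length≥ cs u)) , phyChildren (deleteL v cs) (λ i → phyChild cs ph (keptChild cs u h i))) ,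
    reducedChildren (deleteL v cs) (λ i → reducedChild cs r (keptChild cs u h i))

  -- Under (ii), the 0-edge to a child other than v (a leaf, as inner edges are
  -- 1-edges) provides a zero leaf of the image of the vertex.
  zeroLeafKept : ∀ cs → ReducedL cs → Any (λ p → (proj₁ p ≡ false) × (proj₂ p ≢ leaf v)) cs →
                 Σ ℕ (λ z → z ∈ zerosL (deleteL v cs))
  zeroLeafKept cs r a with find a
  ... | (_ , leaf x) , j , (ef , ne) = x , deleteL-zeros⁺ cs (zerosL⁺ cs j ef (here refl)) (λ { refl → ne refl })
  ... | (_ , node es) , j , (refl , _) with proj₁ (reducedChild cs r j)
  ...   | () , _

  deleteL-image : ∀ cs → Unique (leavesL cs) → ∀ {p} → p ∈ cs → v ∈ leavesC p →
                  ∀ {p'} → p' ∈ deleteL v cs → (p' ≡ deleteC p) ⊎ (p' ∈ cs)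
  deleteL-image cs u i vp j with deleteL⁻ cs j
  ... | q , k , _ , refl with v ∈? leavesC q
  ...   | yes vq = inj₁ (cong deleteC (sharedLeaf cs u k i vq vp))
  ...   | no v∉q = inj₂ (subst (_∈ cs) (sym (deleteC-absent q v∉q)) k)

  deleteBelow : ∀ {t r cs'} → Vertex t r cs' → HasLeafChild v cs' → 3 < suc (length cs') →
                Any (λ p → (proj₁ p ≡ false) × (proj₂ p ≢ leaf v)) cs' → Proper t →
                PhyT (deleteT v t) × Reduced (deleteT v t) × (∀ b → ReducedEdge b t → ReducedEdge b (deleteT v t))
  deleteBelow {node cs'} root h d a P@(_ , r , _) with deleteAtParent cs' P h (≤-pred d)
  ... | ph , r' = ph , r' , λ { b (e , _) → e , zeroLeafKept cs' r a }
  deleteBelow {node cs} (below {p = p} i V) h d a ((l , ph) , r , u)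
    with deleteBelow V h d a (phyChild cs ph i , proj₂ (reducedChild cs r i) , uniqueChild cs u i)
  ... | ph₁ , r₁ , edge₁ =
    (subst (2 ≤_) (sym (deleteL-length-absent cs noLeaf)) l , phyChildren (deleteL v cs) phy) ,
    reducedChildren (deleteL v cs) red , edge
    where
    vp : v ∈ leavesC p
    vp = vertexLeaves V (hasLeafChild⇒∈ h)
    noLeaf : ∀ {b} → (b , leaf v) ∉ cs
    noLeaf k = inner≢leaf (vertexInner V) (sym (cong proj₂ (sharedLeaf cs u k i (here refl) vp)))
    phy : ∀ {p'} → p' ∈ deleteL v cs → PhyT (proj₂ p')
    phy j with deleteL-image cs u i vp j
    ... | inj₁ refl = ph₁
    ... | inj₂ k = phyChild cs ph k
    red : ∀ {p'} → p' ∈ deleteL v cs → ReducedC p'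
    red j with deleteL-image cs u i vp j
    ... | inj₁ refl = edge₁ (proj₁ p) (proj₁ (reducedChild cs r i)) , r₁
    ... | inj₂ k = reducedChild cs r k
    -- a zero leaf of the vertex is not v, since the edge into p is a 1-edge
    edge : ∀ b → ReducedEdge b (node cs) → ReducedEdge b (node (deleteL v cs))
    edge b (e , z , z∈) = e , z , deleteL-zeros⁺ cs z∈ z≢v
      where
      z≢v : z ≢ v
      z≢v refl with zerosL⁻ cs z∈
      ... | q , k , ef , zq with sharedLeaf cs u k i (zeros⊆leaves (proj₂ q) zq) vp
      ...   | refl = false≢true (trans (sym ef) (innerEdge (proj₁ (reducedChild cs r i)) (vertexInner V)))

  conditions⇒good : ∀ cs → Proper (node cs) → CondI (node cs) v ⊎ CondII (node cs) v →
                    PhyT (node (deleteL v cs)) × ReducedL (deleteL v cs)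
  conditions⇒good cs P (inj₁ (_ , root , h , d)) = deleteAtParent cs P h d
  conditions⇒good cs P (inj₂ (true , _ , root , h , d , _)) = deleteAtParent cs P h (<⇒≤ d)
  conditions⇒good cs P (inj₂ (false , _ , V , h , d , a)) with deleteBelow V h d a P
  ... | ph , r , _ = ph , r

-- Restricting a tree without empty vertices to a superset of its leaves
-- changes nothing, so its spanned subtree is obtained by suppression alone.
member-∈ : ∀ {x} L → x ∈ L → member x L ≡ true
member-∈ {x} (y ∷ L) (here refl) = cong (_∨ member x L) (dec-true (x ≟ x) refl)
member-∈ {x} (y ∷ L) (there i) = trans (cong (does (x ≟ y) ∨_) (member-∈ L i)) (∨-zeroʳ _)

mutual
  restrictT-id : ∀ L t → Nonempty t → leavesT t ⊆ L → restrictT L t ≡ just t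
  restrictT-id L (leaf x) _ sub with member x L | member-∈ L (sub (here refl))
  ... | .true | refl = refl
  restrictT-id L (node cs) (l , ne) sub with restrictL L cs | restrictL-id L cs ne sub
  restrictT-id L (node (d ∷ ds)) (l , ne) sub | .(d ∷ ds) | refl = refl

  restrictL-id : ∀ L cs → NonemptyL cs → leavesL cs ⊆ L → restrictL L cs ≡ cs
  restrictL-id L [] _ _ = refl
  restrictL-id L ((b , c) ∷ cs) (nc , ne) sub with restrictT L c | restrictT-id L c nc (λ i → sub (∈-++⁺ˡ i))
  ... | .(just c) | refl = cong ((b , c) ∷_) (restrictL-id L cs ne (λ i → sub (∈-++⁺ʳ (leavesT c) i)))

span-id : ∀ L t → Nonempty t → leavesT t ⊆ L → span L t ≡ just (fixRoot (suppT t))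
span-id L t ne sub with restrictT L t | restrictT-id L t ne sub
... | .(just t) | refl = refl

-- Its spanned subtree S explains the same relation, and the final
-- contraction of S is reduced and phylogenetic, hence isomorphic to T' by (B).
displays-reduced : ∀ cs → Nonempty (node cs) → InnerOnesL cs → Unique (leavesL cs) →
                   ∀ T' → Proper T' → SameX (node cs) T' → Displays (node cs) T'
displays-reduced cs ne ones u T' P' S@((ls , _) , _) =
  S₀ , span-id (leavesT T') (node cs) ne ls , contractT S₀ , contractT-steps S₀ , iso
  where
  S₀ : Tree
  S₀ = fixRoot (suppT (node cs))
  ones₀ : InnerOnes S₀
  ones₀ = suppressed-root-innerOnes cs ones
  leaves≡ : leavesT (contractT S₀) ≡ leavesL cs
  leaves≡ = trans (contractT-leaves S₀) (trans (fixRoot-leaves (suppT (node cs))) (suppress-leaves (node cs)))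
  sameX : SameX (node cs) (contractT S₀)
  sameX = SameX-trans (Equiv⇒SameX (suppress-equiv (node cs)))
            (SameX-trans (fixRoot-sameX (suppT (node cs))) (Equiv⇒SameX (contractT-equiv S₀ ones₀)))
  iso : contractT S₀ ≅ T'
  iso = reduced-unique (contractT S₀) T'
          (contractT-phy S₀ (suppressed-root-phy cs ne) , contractT-reduced S₀ ones₀ , subst Unique (sym leaves≡) u)
          P' (SameX-trans (SameX-sym sameX) S)

lemma13 : (T : Tree) → Phylogenetic T →
          LeastResolved (λ x → x ∈ leavesT T) (XT T) T →
          (v : ℕ) → v ∈ leavesT T →
          (T' : Tree) → Phylogenetic T' →
          LeastResolved (λ x → (x ∈ leavesT T) × (x ≢ v))
                        (λ x y → XT T x y × (x ≢ v) × (y ≢ v)) T' →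
          Displays (deleteT v T) T' ×
          ((T' ≅ deleteT v T) ⇔ (CondI T v ⊎ CondII T v))
lemma13 (leaf _) (() , _) _ _ _ _ _ _
lemma13 (node cs) (_ , ph , u) lr v v∈ T' (_ , ph' , u') lr' =
  displays-reduced (deleteL v cs) nonempty (deleteL-innerOnes v cs (reducedL⇒innerOnesL cs r)) u-v T' P' S ,
  -- T' ≅ T - v makes T - v phylogenetic and reduced, which gives (i) or (ii);
  -- conversely (i) or (ii) makes it so, and (B) applies.
  mk⇔ (λ iso → let ph-v , r-v = good≅ iso (ph' , proj₁ (proj₂ P')) in good⇒conditions v cs v∈ ph-v r-v)
      (λ c → let ph-v , r-v = conditions⇒good v cs (ph , r , u) c in
             reduced-unique T' (node (deleteL v cs)) P' (ph-v , r-v , u-v) (SameX-sym S))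
  where
  r : Reduced (node cs)
  r = leastResolved⇒reduced _ _ (node cs) ph lr
  P' : Proper T'
  P' = ph' , leastResolved⇒reduced _ _ T' ph' lr' , u'
  u-v : Unique (leavesL (deleteL v cs))
  u-v = deleteL-unique v cs u
  nonempty : Nonempty (node (deleteL v cs))
  nonempty = deleteL-length-phy v cs (proj₁ ph) u , deleteL-nonempty v cs (proj₂ ph) u
  S : SameX (node (deleteL v cs)) T'
  S = explains⇒SameX (deletion-explains v cs) (proj₁ lr')
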